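{- Let $n$ be a nonnegative integer, and let $q$, $C$ be indeterminates (with $q^C$ treated as an indeterminate). For an indeterminate $X$ and a positive integer $m$ let $A_m(X)$ denote the $n\times m$ matrix whose entry in row $r$ and column $k$ ($0\le r\le n-1$, $0\le k\le m-1$) is $$[C+r]_q\,[C+r-1]_q\cdots[C+r-k+1]_q\,X^{r-k}$$ (the product of $k$ factors $[C+r]_q,[C+r-1]_q,\dots,[C+r-k+1]_q$; for $k=0$ the entry is $X^r$). Equivalently, each next column arises from the previous one by applying the operator $X^{ -C}D_qX^{C}$, where $D_qf(X)=(f(qX)-f(X))/((q-1)X)$. Given a composition $n=m_1+\dots+m_\ell$ of $n$ into positive integers and indeterminates $X_1,\dots,X_\ell$, there holds $$\det_{1\le i,j\le n}\big(A_{m_1}(X_1)\,A_{m_2}(X_2)\cdots A_{m_\ell}(X_\ell)\big)=q^{N_1}\Big(\prod_{i=1}^{\ell}\prod_{j=1}^{m_i-1}[j]_q!\Big)\prod_{1\le i<j\le\ell}\ \prod_{s=0}^{m_i-1}\prod_{t=0}^{m_j-1}\big(q^{t-s}X_j-X_i\big),$$ where the matrix on the left is the $n\times n$ matrix obtained by placing the blocks side by side, and $$N_1=\sum_{i=1}^{\ell}\sum_{j=1}^{m_i}\Big((C+j+m_1+\dots+m_{i-1}-1)(m_i-j)-\binom{m_i}{3}\Big)-\sum_{1\le i<j\le\ell}\Big(m_i\binom{m_j}{2}-m_j\binom{m_i}{2}\Big).$$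
   Context: $[\alpha]_q=(1-q^\alpha)/(1-q)$, $[j]_q!=[j]_q[j-1]_q\cdots[1]_q$, $[0]_q!=1$. Empty products equal $1$. -}

module Defs where

open import Level using (Level)
open import Algebra.Bundles using (CommutativeRing)
open import Data.Nat as ℕ using (ℕ; zero; suc)
open import Data.Nat.Combinatorics using (_C_)
open import Data.Integer as ℤ using (ℤ; +_; -[1+_])
open import Data.Fin using (Fin; zero; suc; toℕ; punchIn)
open import Data.Fin.Properties using (_<?_)
open import Data.Product using (_×_; _,_)
open import Data.Maybe using (Maybe; just; nothing)
open import Relation.Nullary using (does)
open import Data.Bool using (if_then_else_)

sumℤ : ∀ n → (Fin n → ℤ) → ℤ
sumℤ zero    f = + 0
sumℤ (suc n) f = f zero ℤ.+ sumℤ n (λ i → f (suc i))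

sumℕ : ∀ n → (Fin n → ℕ) → ℕ
sumℕ zero    f = 0
sumℕ (suc n) f = f zero ℕ.+ sumℕ n (λ i → f (suc i))

before : ∀ {ℓ} → (Fin ℓ → ℕ) → Fin ℓ → ℕ
before {ℓ} m i = sumℕ ℓ (λ k → if does (k <? i) then m k else 0)

-- Exponent N₁ = C · N₁C + N₁const, split into the coefficient of C and the constant part.
N₁C : ∀ ℓ → (Fin ℓ → ℕ) → ℕ
N₁C ℓ m = sumℕ ℓ (λ i → sumℕ (m i) (λ j → m i ℕ.∸ suc (toℕ j)))

N₁const : ∀ ℓ → (Fin ℓ → ℕ) → ℤ
N₁const ℓ m =
  sumℤ ℓ (λ i →
      sumℤ (m i) (λ j → -- j here runs over 0..m_i-1, standing for j+1 ∈ 1..m_i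
        (+ (suc (toℕ j) ℕ.+ before m i) ℤ.- + 1) ℤ.* + (m i ℕ.∸ suc (toℕ j)))
      ℤ.- + (m i C 3))
  ℤ.- sumℤ ℓ (λ i → sumℤ ℓ (λ j →
        if does (i <? j)
        then + (m i ℕ.* (m j C 2)) ℤ.- + (m j ℕ.* (m i C 2))
        else + 0))

locate : ∀ ℓ → (Fin ℓ → ℕ) → ℕ → Maybe (Fin ℓ × ℕ)
locate zero    m c = nothing
locate (suc ℓ) m c with c ℕ.<? m zero
... | Relation.Nullary.yes _ = just (zero , c)
... | Relation.Nullary.no  _ with locate ℓ (λ i → m (suc i)) (c ℕ.∸ m zero)
...   | just (i , k) = just (suc i , k)
...   | nothing      = nothing

module RingDefs {c ℓ : Level} (R : CommutativeRing c ℓ) where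
  open CommutativeRing R using (Carrier; _+_; _*_; -_; 0#; 1#)

  _−_ : Carrier → Carrier → Carrier
  x − y = x + (- y)

  _^ℕ_ : Carrier → ℕ → Carrier
  x ^ℕ zero  = 1#
  x ^ℕ suc n = x * (x ^ℕ n)

  -- integer power x^z, given an element xi playing the role of x⁻¹
  zpow : Carrier → Carrier → ℤ → Carrier
  zpow x xi (+ n)    = x ^ℕ n
  zpow x xi -[1+ n ] = xi ^ℕ suc n

  sumR : ∀ n → (Fin n → Carrier) → Carrier
  sumR zero    f = 0#
  sumR (suc n) f = f zero + sumR n (λ i → f (suc i))

  prodR : ∀ n → (Fin n → Carrier) → Carrier
  prodR zero    f = 1#
  prodR (suc n) f = f zero * prodR n (λ i → f (suc i))

  sgn : ℕ → Carrier
  sgn zero    = 1#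
  sgn (suc k) = - sgn k

  det : ∀ n → (Fin n → Fin n → Carrier) → Carrier
  det zero    M = 1#
  det (suc n) M =
    sumR (suc n) (λ j → sgn (toℕ j) * (M zero j * det n (λ r s → M (suc r) (punchIn j s))))

  -- Parameters: q, qi = q⁻¹, w = (1 - q)⁻¹, Q = q^C.
  module QNotation (q qi w Q : Carrier) where

    qnum : ℕ → Carrier
    qnum j = (1# − (q ^ℕ j)) * w

    qfact : ℕ → Carrier
    qfact j = prodR j (λ t → qnum (suc (toℕ t)))

    qC : ℤ → Carrier
    qC z = (1# − (Q * zpow q qi z)) * w

    -- entry (r,k) of A_m(X):  [C+r]_q [C+r-1]_q ⋯ [C+r-k+1]_q X^{r-k}   (Xi = X⁻¹)
    entryA : Carrier → Carrier → ℕ → ℕ → Carrier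
    entryA X Xi r k =
      prodR k (λ i → qC (+ r ℤ.- + toℕ i)) * zpow X Xi (+ r ℤ.- + k)

    blockMatrix : ∀ n ℓ' → (Fin ℓ' → ℕ) → (Fin ℓ' → Carrier) → (Fin ℓ' → Carrier) →
                  Fin n → Fin n → Carrier
    blockMatrix n ℓ' m X Xi r col with locate ℓ' m (toℕ col)
    ... | just (i , k) = entryA (X i) (Xi i) (toℕ r) k
    ... | nothing      = 0#

    qN₁ : ∀ ℓ' → (Fin ℓ' → ℕ) → Carrier
    qN₁ ℓ' m = (Q ^ℕ N₁C ℓ' m) * zpow q qi (N₁const ℓ' m)

    factProd : ∀ ℓ' → (Fin ℓ' → ℕ) → Carrier
    factProd ℓ' m = prodR ℓ' (λ i → prodR (m i ℕ.∸ 1) (λ j → qfact (suc (toℕ j))))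

    vdmProd : ∀ ℓ' → (Fin ℓ' → ℕ) → (Fin ℓ' → Carrier) → Carrier
    vdmProd ℓ' m X = prodR ℓ' (λ i → prodR ℓ' (λ j →
      if does (i <? j)
      then prodR (m i) (λ s → prodR (m j) (λ t →
             (zpow q qi (+ toℕ t ℤ.- + toℕ s) * X j) − X i))
      else 1#))

-- Since [C + r - t]_q = (1 - q)⁻¹ (1 - q^C q^(-t) · q^r) is linear in q^r, the entry in row r and
-- column k of A_m(X) is X^(-k) times a polynomial of degree k in q^r, i.e. a combination
-- Σ_{j ≤ k} c_kj X^(-k) (q^j X)^r of Vandermonde columns in the nodes q^j X. Column operations thus
-- turn the block matrix into the Vandermonde matrix of the nodes q^j X_i (j < m_i), and its determinant
-- is the product of the leading coefficients c_kk X^(-k) times the Vandermonde product. Inside a block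
-- the differences q^k X - q^s X combine with the leading coefficients into q-factorials and powers of
-- q^C; across blocks they give the factors q^(t-s) X_j - X_i up to powers of q, and all these
-- exponents add up to N₁.
module Submission where

open import Defs
open import Level using (Level)
open import Algebra.Bundles using (CommutativeRing; CommutativeMonoid)
open import Data.Nat using (ℕ; _≤_)
open import Data.Fin using (Fin)
open import Relation.Binary.PropositionalEquality using (_≡_)

open import Data.Bool using (if_then_else_)
open import Data.Empty using (⊥-elim)
open import Data.Fin as F using (toℕ; punchIn)
open import Data.Fin.Properties using (_<?_)
open import Data.Integer as ℤ using (ℤ; +_; -[1+_])
import Data.Integer.Properties as ℤP
open import Data.List using (List; []; _∷_)
open import Data.Maybe as Maybe using (Maybe; just; nothing)
open import Data.Nat as ℕ using (zero; suc; _<_; _∸_; z≤n; s≤s)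
open import Data.Nat.Combinatorics using (_C_; nC1≡n; nCk+nC[k+1]≡[n+1]C[k+1])
import Data.Nat.Properties as ℕP
open import Data.Product as Prod using (_×_; _,_)
open import Data.Sign as Sign using (Sign)
open import Function using (_∘_)
open import Relation.Binary.Definitions using (tri<; tri≈; tri>)
open import Relation.Binary.PropositionalEquality as ≡ using (_≢_)
open import Relation.Nullary using (does; yes; no; ¬_)
import Algebra.Solver.Ring.AlmostCommutativeRing as ACR

-- The library ring solver needs coefficients with decidable equality; ℤ maps into every commutative ring.
module IntegerCoefficientSolver {c r : Level} (R : CommutativeRing c r) where
  open CommutativeRing R
  open import Algebra.Properties.Semiring.Mult.TCOptimised semiring using (×-homo-+; ×1-homo-*) renaming (_×_ to _×ᵣ_)
  open import Algebra.Properties.Ring ring using (-1*x≈-x; -0#≈0#)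
  open import Algebra.Properties.AbelianGroup +-abelianGroup using (⁻¹-∙-comm)
  open import Algebra.Properties.Group +-group using (⁻¹-involutive)
  open import Relation.Binary.Reasoning.Setoid setoid

  fromℤ : ℤ → Carrier
  fromℤ (+ n)    = n ×ᵣ 1#
  fromℤ -[1+ n ] = - (suc n ×ᵣ 1#)

  private
    fromSign : Sign → Carrier
    fromSign Sign.+ = 1#
    fromSign Sign.- = - 1#

    fromSign-homo-* : ∀ s t → fromSign (s Sign.* t) ≈ fromSign s * fromSign t
    fromSign-homo-* Sign.+ t       = sym (*-identityˡ _)
    fromSign-homo-* Sign.- Sign.+ = sym (*-identityʳ _)
    fromSign-homo-* Sign.- Sign.- = trans (sym (⁻¹-involutive 1#)) (sym (-1*x≈-x _))

    fromℤ-◃ : ∀ s n → fromℤ (s ℤ.◃ n) ≈ fromSign s * (n ×ᵣ 1#)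
    fromℤ-◃ s      zero    = sym (zeroʳ _)
    fromℤ-◃ Sign.+ (suc n) = sym (*-identityˡ _)
    fromℤ-◃ Sign.- (suc n) = sym (-1*x≈-x _)

    fromℤ-sign : ∀ x → fromℤ x ≈ fromSign (ℤ.sign x) * (ℤ.∣ x ∣ ×ᵣ 1#)
    fromℤ-sign x = trans (≡.subst (λ y → fromℤ x ≈ fromℤ y) (≡.sym (ℤP.◃-inverse x)) refl)
                         (fromℤ-◃ (ℤ.sign x) ℤ.∣ x ∣)

    fromℤ-⊖ : ∀ m n → fromℤ (m ℤ.⊖ n) ≈ m ×ᵣ 1# + - (n ×ᵣ 1#)
    fromℤ-⊖ m zero = begin
      fromℤ (m ℤ.⊖ 0)    ≡⟨ ≡.cong fromℤ (ℤP.⊖-≥ {m} {0} z≤n) ⟩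
      m ×ᵣ 1#             ≈⟨ sym (+-identityʳ _) ⟩
      m ×ᵣ 1# + 0#        ≈⟨ +-congˡ (sym -0#≈0#) ⟩
      m ×ᵣ 1# + - 0#      ∎
    fromℤ-⊖ zero    (suc n) = sym (+-identityˡ _)
    fromℤ-⊖ (suc m) (suc n) = begin
      fromℤ (suc m ℤ.⊖ suc n)           ≡⟨ ≡.cong fromℤ (ℤP.[1+m]⊖[1+n]≡m⊖n m n) ⟩
      fromℤ (m ℤ.⊖ n)                   ≈⟨ fromℤ-⊖ m n ⟩
      m ×ᵣ 1# + - (n ×ᵣ 1#)               ≈⟨ cancel (m ×ᵣ 1#) (n ×ᵣ 1#) ⟩
      (1# + m ×ᵣ 1#) + - (1# + n ×ᵣ 1#)   ≈⟨ sym (+-cong (×-homo-+ 1# 1 m) (-‿cong (×-homo-+ 1# 1 n))) ⟩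
      suc m ×ᵣ 1# + - (suc n ×ᵣ 1#)       ∎
      where
      cancel : ∀ a b → a + - b ≈ (1# + a) + - (1# + b)
      cancel a b = begin
        a + - b                     ≈⟨ sym (+-identityˡ _) ⟩
        0# + (a + - b)              ≈⟨ +-congʳ (sym (-‿inverseʳ 1#)) ⟩
        (1# + - 1#) + (a + - b)     ≈⟨ +-assoc _ _ _ ⟩
        1# + (- 1# + (a + - b))     ≈⟨ +-congˡ (sym (+-assoc _ _ _)) ⟩
        1# + ((- 1# + a) + - b)     ≈⟨ +-congˡ (+-congʳ (+-comm _ _)) ⟩
        1# + ((a + - 1#) + - b)     ≈⟨ +-congˡ (+-assoc _ _ _) ⟩
        1# + (a + (- 1# + - b))     ≈⟨ sym (+-assoc _ _ _) ⟩
        (1# + a) + (- 1# + - b)     ≈⟨ +-congˡ (⁻¹-∙-comm _ _) ⟩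
        (1# + a) + - (1# + b)       ∎

  fromℤ-homo-+ : ∀ x y → fromℤ (x ℤ.+ y) ≈ fromℤ x + fromℤ y
  fromℤ-homo-+ (+ m)    (+ n)    = ×-homo-+ 1# m n
  fromℤ-homo-+ (+ m)    -[1+ n ] = fromℤ-⊖ m (suc n)
  fromℤ-homo-+ -[1+ m ] (+ n)    = trans (fromℤ-⊖ n (suc m)) (+-comm _ _)
  fromℤ-homo-+ -[1+ m ] -[1+ n ] = begin
    - (suc (suc (m ℕ.+ n)) ×ᵣ 1#)          ≡⟨ ≡.cong (λ k → - (k ×ᵣ 1#)) (≡.sym (ℕP.+-suc (suc m) n)) ⟩
    - ((suc m ℕ.+ suc n) ×ᵣ 1#)            ≈⟨ -‿cong (×-homo-+ 1# (suc m) (suc n)) ⟩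
    - (suc m ×ᵣ 1# + suc n ×ᵣ 1#)           ≈⟨ sym (⁻¹-∙-comm _ _) ⟩
    - (suc m ×ᵣ 1#) + - (suc n ×ᵣ 1#)       ∎

  fromℤ-homo-* : ∀ x y → fromℤ (x ℤ.* y) ≈ fromℤ x * fromℤ y
  fromℤ-homo-* x y = begin
    fromℤ (x ℤ.* y)
      ≈⟨ fromℤ-◃ (sx Sign.* sy) (∣x∣ ℕ.* ∣y∣) ⟩
    fromSign (sx Sign.* sy) * ((∣x∣ ℕ.* ∣y∣) ×ᵣ 1#)
      ≈⟨ *-cong (fromSign-homo-* sx sy) (×1-homo-* ∣x∣ ∣y∣) ⟩
    (fromSign sx * fromSign sy) * ((∣x∣ ×ᵣ 1#) * (∣y∣ ×ᵣ 1#))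
      ≈⟨ interchange _ _ _ _ ⟩
    (fromSign sx * (∣x∣ ×ᵣ 1#)) * (fromSign sy * (∣y∣ ×ᵣ 1#))
      ≈⟨ sym (*-cong (fromℤ-sign x) (fromℤ-sign y)) ⟩
    fromℤ x * fromℤ y ∎
    where
    sx = ℤ.sign x
    sy = ℤ.sign y
    ∣x∣ = ℤ.∣ x ∣
    ∣y∣ = ℤ.∣ y ∣
    interchange : ∀ a b u v → (a * b) * (u * v) ≈ (a * u) * (b * v)
    interchange a b u v = begin
      (a * b) * (u * v)   ≈⟨ *-assoc _ _ _ ⟩
      a * (b * (u * v))   ≈⟨ *-congˡ (sym (*-assoc _ _ _)) ⟩
      a * ((b * u) * v)   ≈⟨ *-congˡ (*-congʳ (*-comm _ _)) ⟩
      a * ((u * b) * v)   ≈⟨ *-congˡ (*-assoc _ _ _) ⟩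
      a * (u * (b * v))   ≈⟨ sym (*-assoc _ _ _) ⟩
      (a * u) * (b * v)   ∎

  fromℤ-homo-‿ : ∀ x → fromℤ (ℤ.- x) ≈ - fromℤ x
  fromℤ-homo-‿ (+ zero)  = sym -0#≈0#
  fromℤ-homo-‿ (+ suc n) = refl
  fromℤ-homo-‿ -[1+ n ]  = sym (⁻¹-involutive _)

  private
    almostCommutativeRing : ACR.AlmostCommutativeRing c r
    almostCommutativeRing = ACR.fromCommutativeRing R

    fromℤ-morphism : ℤ.+-*-rawRing ACR.-Raw-AlmostCommutative⟶ almostCommutativeRing
    fromℤ-morphism = record
      { ⟦_⟧    = fromℤ
      ; +-homo = fromℤ-homo-+
      ; *-homo = fromℤ-homo-*
      ; -‿homo = fromℤ-homo-‿
      ; 0-homo = refl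
      ; 1-homo = refl
      }

    _≟ℤ_ : ∀ x y → Maybe (fromℤ x ≈ fromℤ y)
    x ≟ℤ y with x ℤ.≟ y
    ... | yes ≡.refl = just refl
    ... | no _       = nothing

  open import Algebra.Solver.Ring ℤ.+-*-rawRing almostCommutativeRing fromℤ-morphism _≟ℤ_ public

module BigOperator {c r : Level} (M : CommutativeMonoid c r) where
  open CommutativeMonoid M
  open import Relation.Binary.Reasoning.Setoid setoid

  big : ℕ → (ℕ → Carrier) → Carrier
  big zero    f = ε
  big (suc n) f = f 0 ∙ big n (λ i → f (suc i))

  big-cong : ∀ n {f g : ℕ → Carrier} → (∀ i → i < n → f i ≈ g i) → big n f ≈ big n g
  big-cong zero    f≈g = refl
  big-cong (suc n) f≈g = ∙-cong (f≈g 0 (s≤s z≤n)) (big-cong n (λ i i<n → f≈g (suc i) (s≤s i<n)))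

  big-ε : ∀ n (f : ℕ → Carrier) → (∀ i → i < n → f i ≈ ε) → big n f ≈ ε
  big-ε n f f≈ε = trans (big-cong n f≈ε) (ε-big n)
    where
    ε-big : ∀ n → big n (λ _ → ε) ≈ ε
    ε-big zero    = refl
    ε-big (suc n) = trans (identityˡ _) (ε-big n)

  big-∙ : ∀ n (f g : ℕ → Carrier) → big n (λ i → f i ∙ g i) ≈ big n f ∙ big n g
  big-∙ zero    f g = sym (identityˡ ε)
  big-∙ (suc n) f g = begin
    (f 0 ∙ g 0) ∙ big n (λ i → f (suc i) ∙ g (suc i))
      ≈⟨ ∙-congˡ (big-∙ n _ _) ⟩
    (f 0 ∙ g 0) ∙ (big n (λ i → f (suc i)) ∙ big n (λ i → g (suc i)))
      ≈⟨ interchange _ _ _ _ ⟩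
    (f 0 ∙ big n (λ i → f (suc i))) ∙ (g 0 ∙ big n (λ i → g (suc i))) ∎
    where open import Algebra.Properties.CommutativeSemigroup commutativeSemigroup using (interchange)

  big-split : ∀ a b (f : ℕ → Carrier) → big (a ℕ.+ b) f ≈ big a f ∙ big b (λ i → f (a ℕ.+ i))
  big-split zero    b f = sym (identityˡ _)
  big-split (suc a) b f = trans (∙-congˡ (big-split a b _)) (sym (assoc _ _ _))

  big-last : ∀ n (f : ℕ → Carrier) → big (suc n) f ≈ big n f ∙ f n
  big-last n f = begin
    big (suc n) f                  ≡⟨ ≡.cong (λ k → big k f) (ℕP.+-comm 1 n) ⟩
    big (n ℕ.+ 1) f                ≈⟨ big-split n 1 f ⟩
    big n f ∙ (f (n ℕ.+ 0) ∙ ε)    ≈⟨ ∙-congˡ (identityʳ _) ⟩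
    big n f ∙ f (n ℕ.+ 0)          ≡⟨ ≡.cong (λ k → big n f ∙ f k) (ℕP.+-identityʳ n) ⟩
    big n f ∙ f n                  ∎

open BigOperator ℕP.+-0-commutativeMonoid using ()
  renaming (big to Σℕ; big-cong to Σℕ-cong; big-∙ to Σℕ-+; big-last to Σℕ-last)

Σℕ-*ˡ : ∀ n c (f : ℕ → ℕ) → Σℕ n (λ i → c ℕ.* f i) ≡ c ℕ.* Σℕ n f
Σℕ-*ˡ zero    c f = ≡.sym (ℕP.*-zeroʳ c)
Σℕ-*ˡ (suc n) c f = ≡.trans (≡.cong (c ℕ.* f 0 ℕ.+_) (Σℕ-*ˡ n c _)) (≡.sym (ℕP.*-distribˡ-+ c (f 0) _))

module PunchInℕ where

  punchInℕ : ℕ → ℕ → ℕ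
  punchInℕ zero    s       = suc s
  punchInℕ (suc j) zero    = zero
  punchInℕ (suc j) (suc s) = suc (punchInℕ j s)

  punchOutℕ : ℕ → ℕ → ℕ
  punchOutℕ zero    zero    = zero
  punchOutℕ zero    (suc b) = b
  punchOutℕ (suc j) zero    = zero
  punchOutℕ (suc j) (suc b) = suc (punchOutℕ j b)

  toℕ-punchIn : ∀ {n} (j : Fin (suc n)) (s : Fin n) → toℕ (punchIn j s) ≡ punchInℕ (toℕ j) (toℕ s)
  toℕ-punchIn F.zero    s         = ≡.refl
  toℕ-punchIn (F.suc j) F.zero    = ≡.refl
  toℕ-punchIn (F.suc j) (F.suc s) = ≡.cong suc (toℕ-punchIn j s)

  punchInℕ-punchOutℕ : ∀ {j b} → j ≢ b → punchInℕ j (punchOutℕ j b) ≡ b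
  punchInℕ-punchOutℕ {zero}  {zero}  j≢b = ⊥-elim (j≢b ≡.refl)
  punchInℕ-punchOutℕ {zero}  {suc b} j≢b = ≡.refl
  punchInℕ-punchOutℕ {suc j} {zero}  j≢b = ≡.refl
  punchInℕ-punchOutℕ {suc j} {suc b} j≢b = ≡.cong suc (punchInℕ-punchOutℕ (j≢b ∘ ≡.cong suc))

  punchInℕ-suc-punchOutℕ : ∀ {j b} → j ≢ b → j ≢ suc b → punchInℕ j (suc (punchOutℕ j b)) ≡ suc b
  punchInℕ-suc-punchOutℕ {zero}        {zero}  j≢b _    = ⊥-elim (j≢b ≡.refl)
  punchInℕ-suc-punchOutℕ {zero}        {suc b} _   _    = ≡.refl
  punchInℕ-suc-punchOutℕ {suc zero}    {zero}  _   j≢1  = ⊥-elim (j≢1 ≡.refl)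
  punchInℕ-suc-punchOutℕ {suc (suc j)} {zero}  _   _    = ≡.refl
  punchInℕ-suc-punchOutℕ {suc j}       {suc b} j≢b j≢b+1 =
    ≡.cong suc (punchInℕ-suc-punchOutℕ (j≢b ∘ ≡.cong suc) (j≢b+1 ∘ ≡.cong suc))

  punchInℕ-injective : ∀ j s t → punchInℕ j s ≡ punchInℕ j t → s ≡ t
  punchInℕ-injective zero    s       t       eq = ℕP.suc-injective eq
  punchInℕ-injective (suc j) zero    zero    eq = ≡.refl
  punchInℕ-injective (suc j) (suc s) (suc t) eq = ≡.cong suc (punchInℕ-injective j s t (ℕP.suc-injective eq))

  punchInℕᵢ≢i : ∀ j s → punchInℕ j s ≢ j
  punchInℕᵢ≢i (suc j) (suc s) eq = punchInℕᵢ≢i j s (ℕP.suc-injective eq)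

  punchInℕ-≢ : ∀ j {s b} → s ≢ b → punchInℕ j s ≢ punchInℕ j b
  punchInℕ-≢ j s≢b = s≢b ∘ punchInℕ-injective j _ _

  punchInℕ-< : ∀ j {s n} → s < n → punchInℕ j s < suc n
  punchInℕ-< j {s} s<n = s≤s (ℕP.≤-trans (punchInℕ-≤ j s) s<n)
    where
    punchInℕ-≤ : ∀ j s → punchInℕ j s ≤ suc s
    punchInℕ-≤ zero    s       = ℕP.≤-refl
    punchInℕ-≤ (suc j) zero    = z≤n
    punchInℕ-≤ (suc j) (suc s) = s≤s (punchInℕ-≤ j s)

  punchInℕ-<⁻¹ : ∀ {j s n} → j < suc n → punchInℕ j s < suc n → s < n
  punchInℕ-<⁻¹ {zero}  {s}     {n}     _              (s≤s s<n) = s<n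
  punchInℕ-<⁻¹ {suc j} {zero}  {suc n} _              _         = s≤s z≤n
  punchInℕ-<⁻¹ {suc j} {suc s} {suc n} (s≤s j<n+1)    (s≤s lt)  = s≤s (punchInℕ-<⁻¹ j<n+1 lt)
  punchInℕ-<⁻¹ {suc j} {_}     {zero}  (s≤s ())       _

  punchInℕ-step : ∀ {b s} → s ≢ b → punchInℕ b s ≡ punchInℕ (suc b) s
  punchInℕ-step {zero}  {zero}  s≢b = ⊥-elim (s≢b ≡.refl)
  punchInℕ-step {zero}  {suc s} s≢b = ≡.refl
  punchInℕ-step {suc b} {zero}  s≢b = ≡.refl
  punchInℕ-step {suc b} {suc s} s≢b = ≡.cong suc (punchInℕ-step (s≢b ∘ ≡.cong suc))

  punchInℕ-diag : ∀ b → punchInℕ b b ≡ suc b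
  punchInℕ-diag zero    = ≡.refl
  punchInℕ-diag (suc b) = ≡.cong suc (punchInℕ-diag b)

  punchInℕ-subdiag : ∀ b → punchInℕ (suc b) b ≡ b
  punchInℕ-subdiag zero    = ≡.refl
  punchInℕ-subdiag (suc b) = ≡.cong suc (punchInℕ-subdiag b)

  punchInℕ-≢-diag : ∀ {b s} → s ≢ b → punchInℕ b s ≢ suc b
  punchInℕ-≢-diag {b} s≢b eq = punchInℕ-≢ b s≢b (≡.trans eq (≡.sym (punchInℕ-diag b)))

  punchInℕ-≢-subdiag : ∀ {b s} → s ≢ b → punchInℕ (suc b) s ≢ b
  punchInℕ-≢-subdiag {b} s≢b eq = punchInℕ-≢ (suc b) s≢b (≡.trans eq (≡.sym (punchInℕ-subdiag b)))

  punchOutℕ-< : ∀ {j b n} → j < suc n → b < suc n → j ≢ b → punchOutℕ j b < n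
  punchOutℕ-< {j} {b} {n} j<n+1 b<n+1 j≢b =
    punchInℕ-<⁻¹ j<n+1 (≡.subst (_< suc n) (≡.sym (punchInℕ-punchOutℕ j≢b)) b<n+1)

  suc-punchOutℕ-< : ∀ {j b n} → j < suc n → suc b < suc n → j ≢ b → j ≢ suc b → suc (punchOutℕ j b) < n
  suc-punchOutℕ-< {j} {b} {n} j<n+1 b+1<n+1 j≢b j≢b+1 =
    punchInℕ-<⁻¹ j<n+1 (≡.subst (_< suc n) (≡.sym (punchInℕ-suc-punchOutℕ j≢b j≢b+1)) b+1<n+1)

module RingToolkit {c r : Level} (R : CommutativeRing c r) where
  open CommutativeRing R public hiding (zero)
  open RingDefs R public
  open import Relation.Binary.Reasoning.Setoid setoid public
  open IntegerCoefficientSolver R public using (solve; _:=_; _:+_; _:*_; :-_; _:-_; con)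
  open import Algebra.Properties.Semiring.Exp semiring using (_^_; ^-homo-*; ^-assocʳ; ^-congˡ)
  open import Algebra.Properties.CommutativeSemiring.Exp commutativeSemiring using (^-distrib-*)
  open import Algebra.Properties.Ring ring public using (-0#≈0#; -‿involutive)
  open import Algebra.Properties.AbelianGroup +-abelianGroup using (⁻¹-∙-comm)

  open BigOperator +-commutativeMonoid public using ()
    renaming (big to ΣN; big-cong to ΣN-cong; big-ε to ΣN-0; big-∙ to ΣN-+; big-last to ΣN-last)
  open BigOperator *-commutativeMonoid public using ()
    renaming (big to ΠN; big-cong to ΠN-cong; big-ε to ΠN-1; big-∙ to ΠN-*; big-split to ΠN-split;
              big-last to ΠN-last)

  ΣN-*ˡ : ∀ n a (f : ℕ → Carrier) → ΣN n (λ i → a * f i) ≈ a * ΣN n f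
  ΣN-*ˡ zero    a f = sym (zeroʳ a)
  ΣN-*ˡ (suc n) a f = trans (+-congˡ (ΣN-*ˡ n a _)) (sym (distribˡ a _ _))

  ΣN-*ʳ : ∀ n a (f : ℕ → Carrier) → ΣN n (λ i → f i * a) ≈ ΣN n f * a
  ΣN-*ʳ zero    a f = sym (zeroˡ a)
  ΣN-*ʳ (suc n) a f = trans (+-congˡ (ΣN-*ʳ n a _)) (sym (distribʳ a _ _))

  ΣN-‿ : ∀ n (f : ℕ → Carrier) → ΣN n (λ i → - f i) ≈ - ΣN n f
  ΣN-‿ zero    f = sym -0#≈0#
  ΣN-‿ (suc n) f = trans (+-congˡ (ΣN-‿ n _)) (⁻¹-∙-comm _ _)

  sumR≈ΣN : ∀ n {f : Fin n → Carrier} {g : ℕ → Carrier} → (∀ i → f i ≈ g (toℕ i)) → sumR n f ≈ ΣN n g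
  sumR≈ΣN zero    f≈g = refl
  sumR≈ΣN (suc n) f≈g = +-cong (f≈g F.zero) (sumR≈ΣN n (f≈g ∘ F.suc))

  prodR≈ΠN : ∀ n {f : Fin n → Carrier} {g : ℕ → Carrier} → (∀ i → f i ≈ g (toℕ i)) → prodR n f ≈ ΠN n g
  prodR≈ΠN zero    f≈g = refl
  prodR≈ΠN (suc n) f≈g = *-cong (f≈g F.zero) (prodR≈ΠN n (f≈g ∘ F.suc))

  prodR-cong : ∀ n {f g : Fin n → Carrier} → (∀ i → f i ≈ g i) → prodR n f ≈ prodR n g
  prodR-cong zero    f≈g = refl
  prodR-cong (suc n) f≈g = *-cong (f≈g F.zero) (prodR-cong n (f≈g ∘ F.suc))

  prodR-* : ∀ n (f g : Fin n → Carrier) → prodR n (λ i → f i * g i) ≈ prodR n f * prodR n g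
  prodR-* zero    f g = sym (*-identityˡ 1#)
  prodR-* (suc n) f g = trans (*-congˡ (prodR-* n _ _))
    (solve 4 (λ a b x y → (a :* b) :* (x :* y) := (a :* x) :* (b :* y)) refl _ _ _ _)

  ΠN-prodR-comm : ∀ a n (f : ℕ → Fin n → Carrier) →
                  ΠN a (λ s → prodR n (f s)) ≈ prodR n (λ j → ΠN a (λ s → f s j))
  ΠN-prodR-comm a zero    f = ΠN-1 a _ (λ _ _ → refl)
  ΠN-prodR-comm a (suc n) f = trans (ΠN-* a _ _) (*-congˡ (ΠN-prodR-comm a n (λ s j → f s (F.suc j))))

  ^ℕ≡^ : ∀ x n → x ^ℕ n ≡ x ^ n
  ^ℕ≡^ x zero    = ≡.refl
  ^ℕ≡^ x (suc n) = ≡.cong (x *_) (^ℕ≡^ x n)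

  ^ℕ-congˡ : ∀ n {x y} → x ≈ y → x ^ℕ n ≈ y ^ℕ n
  ^ℕ-congˡ n {x} {y} rewrite ^ℕ≡^ x n | ^ℕ≡^ y n = ^-congˡ n

  ^ℕ-homo-* : ∀ x m n → x ^ℕ (m ℕ.+ n) ≈ x ^ℕ m * x ^ℕ n
  ^ℕ-homo-* x m n rewrite ^ℕ≡^ x (m ℕ.+ n) | ^ℕ≡^ x m | ^ℕ≡^ x n = ^-homo-* x m n

  ^ℕ-assocʳ : ∀ x m n → (x ^ℕ m) ^ℕ n ≈ x ^ℕ (m ℕ.* n)
  ^ℕ-assocʳ x m n rewrite ^ℕ≡^ (x ^ℕ m) n | ^ℕ≡^ x m | ^ℕ≡^ x (m ℕ.* n) = ^-assocʳ x m n

  ^ℕ-distrib-* : ∀ x y n → (x * y) ^ℕ n ≈ x ^ℕ n * y ^ℕ n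
  ^ℕ-distrib-* x y n rewrite ^ℕ≡^ (x * y) n | ^ℕ≡^ x n | ^ℕ≡^ y n = ^-distrib-* x y n

  ^ℕ-comm : ∀ x m n → (x ^ℕ m) ^ℕ n ≈ (x ^ℕ n) ^ℕ m
  ^ℕ-comm x m n = begin
    (x ^ℕ m) ^ℕ n  ≈⟨ ^ℕ-assocʳ x m n ⟩
    x ^ℕ (m ℕ.* n) ≡⟨ ≡.cong (x ^ℕ_) (ℕP.*-comm m n) ⟩
    x ^ℕ (n ℕ.* m) ≈⟨ sym (^ℕ-assocʳ x n m) ⟩
    (x ^ℕ n) ^ℕ m  ∎

  ΠN-const : ∀ n x → ΠN n (λ _ → x) ≈ x ^ℕ n
  ΠN-const zero    x = refl
  ΠN-const (suc n) x = *-congˡ (ΠN-const n x)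

  ΠN-^ℕ : ∀ n x (f : ℕ → ℕ) → ΠN n (λ i → x ^ℕ f i) ≈ x ^ℕ Σℕ n f
  ΠN-^ℕ zero    x f = refl
  ΠN-^ℕ (suc n) x f = trans (*-congˡ (ΠN-^ℕ n x _)) (sym (^ℕ-homo-* x (f 0) _))

  prodR-^ℕ : ∀ n x (f : Fin n → ℕ) → prodR n (λ i → x ^ℕ f i) ≈ x ^ℕ sumℕ n f
  prodR-^ℕ zero    x f = refl
  prodR-^ℕ (suc n) x f = trans (*-congˡ (prodR-^ℕ n x _)) (sym (^ℕ-homo-* x (f F.zero) _))

  module _ {x xi : Carrier} (x*xi≈1 : x * xi ≈ 1#) where

    xi^n*x^n≈1 : ∀ n → xi ^ℕ n * x ^ℕ n ≈ 1#
    xi^n*x^n≈1 n = begin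
      xi ^ℕ n * x ^ℕ n ≈⟨ sym (^ℕ-distrib-* xi x n) ⟩
      (xi * x) ^ℕ n    ≈⟨ ^ℕ-congˡ n (trans (*-comm xi x) x*xi≈1) ⟩
      1# ^ℕ n          ≈⟨ 1^ℕn≈1 n ⟩
      1#               ∎
      where
      1^ℕn≈1 : ∀ n → 1# ^ℕ n ≈ 1#
      1^ℕn≈1 zero    = refl
      1^ℕn≈1 (suc n) = trans (*-identityˡ _) (1^ℕn≈1 n)

    zpow-⊖ : ∀ a b → zpow x xi (+ a ℤ.- + b) ≈ xi ^ℕ b * x ^ℕ a
    zpow-⊖ a b = trans (reflexive (≡.cong (zpow x xi) (ℤP.m-n≡m⊖n a b))) (go a b)
      where
      go : ∀ a b → zpow x xi (a ℤ.⊖ b) ≈ xi ^ℕ b * x ^ℕ a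
      go a       zero    = trans (reflexive (≡.cong (zpow x xi) (ℤP.⊖-≥ {a} {0} z≤n))) (sym (*-identityˡ _))
      go zero    (suc b) = sym (*-identityʳ _)
      go (suc a) (suc b) = begin
        zpow x xi (suc a ℤ.⊖ suc b)        ≡⟨ ≡.cong (zpow x xi) (ℤP.[1+m]⊖[1+n]≡m⊖n a b) ⟩
        zpow x xi (a ℤ.⊖ b)                ≈⟨ go a b ⟩
        xi ^ℕ b * x ^ℕ a                   ≈⟨ sym (*-identityˡ _) ⟩
        1# * (xi ^ℕ b * x ^ℕ a)            ≈⟨ *-congʳ (sym x*xi≈1) ⟩
        (x * xi) * (xi ^ℕ b * x ^ℕ a)
          ≈⟨ solve 4 (λ x y u v → (x :* y) :* (u :* v) := (y :* u) :* (x :* v)) refl _ _ _ _ ⟩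
        (xi * xi ^ℕ b) * (x * x ^ℕ a)      ∎

  ΣN-cong-pair : ∀ n b {f g : ℕ → Carrier} → suc b < n →
    (∀ j → j < n → j ≢ b → j ≢ suc b → f j ≈ g j) →
    f b + f (suc b) ≈ g b + g (suc b) → ΣN n f ≈ ΣN n g
  ΣN-cong-pair (suc (suc n)) zero {f} {g} _ f≈g pair≈ = begin
    f 0 + (f 1 + ΣN n (λ i → f (suc (suc i))))   ≈⟨ sym (+-assoc _ _ _) ⟩
    (f 0 + f 1) + ΣN n (λ i → f (suc (suc i)))   ≈⟨ +-cong pair≈ (ΣN-cong n λ i i<n → f≈g _ (s≤s (s≤s i<n)) (λ ()) (λ ())) ⟩
    (g 0 + g 1) + ΣN n (λ i → g (suc (suc i)))   ≈⟨ +-assoc _ _ _ ⟩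
    g 0 + (g 1 + ΣN n (λ i → g (suc (suc i))))   ∎
  ΣN-cong-pair (suc n) (suc b) (s≤s b+1<n) f≈g pair≈ =
    +-cong (f≈g 0 (s≤s z≤n) (λ ()) (λ ()))
           (ΣN-cong-pair n b b+1<n (λ j j<n j≢b j≢b+1 →
              f≈g (suc j) (s≤s j<n) (j≢b ∘ ℕP.suc-injective) (j≢b+1 ∘ ℕP.suc-injective)) pair≈)

  ΠN-reverse : ∀ n (g : ℕ → Carrier) → ΠN n (λ t → g (n ∸ t)) ≈ ΠN n (λ t → g (suc t))
  ΠN-reverse zero    g = refl
  ΠN-reverse (suc n) g = begin
    g (suc n) * ΠN n (λ t → g (n ∸ t))  ≈⟨ *-congˡ (ΠN-reverse n g) ⟩
    g (suc n) * ΠN n (λ t → g (suc t))  ≈⟨ *-comm _ _ ⟩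
    ΠN n (λ t → g (suc t)) * g (suc n)  ≈⟨ sym (ΠN-last n (λ t → g (suc t))) ⟩
    ΠN (suc n) (λ t → g (suc t))        ∎

module Determinant {c r : Level} (R : CommutativeRing c r) where
  open RingToolkit R
  open PunchInℕ

  -- ℕ-indexed matrices avoid arithmetic on Fin; detℕ n only reads the upper left n × n corner.
  Matrix : Set c
  Matrix = ℕ → ℕ → Carrier

  minor : ℕ → Matrix → Matrix
  minor j M r s = M (suc r) (punchInℕ j s)

  detℕ : ℕ → Matrix → Carrier
  detℕ zero    M = 1#
  detℕ (suc n) M = ΣN (suc n) (λ j → sgn j * (M 0 j * detℕ n (minor j M)))

  det≈detℕ : ∀ n {M : Fin n → Fin n → Carrier} {N : Matrix} →
             (∀ r s → M r s ≈ N (toℕ r) (toℕ s)) → det n M ≈ detℕ n N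
  det≈detℕ zero    M≈N = refl
  det≈detℕ (suc n) {M} {N} M≈N = sumR≈ΣN (suc n) {g = λ j → sgn j * (N 0 j * detℕ n (minor j N))} λ j →
    *-congˡ {sgn (toℕ j)} (*-cong (M≈N F.zero j) (det≈detℕ n λ r s →
      trans (M≈N (F.suc r) (punchIn j s)) (reflexive (≡.cong (N (suc (toℕ r))) (toℕ-punchIn j s)))))

  detℕ-cong : ∀ n {M N : Matrix} → (∀ r s → r < n → s < n → M r s ≈ N r s) → detℕ n M ≈ detℕ n N
  detℕ-cong zero    M≈N = refl
  detℕ-cong (suc n) M≈N = ΣN-cong (suc n) λ j j<n →
    *-congˡ {sgn j} (*-cong (M≈N 0 j (s≤s z≤n) j<n)
                    (detℕ-cong n λ r s r<n s<n → M≈N (suc r) (punchInℕ j s) (s≤s r<n) (punchInℕ-< j s<n)))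

  detℕ-linear : ∀ n {M N P : Matrix} b a e → b < n →
    (∀ r s → s ≢ b → M r s ≈ N r s) → (∀ r s → s ≢ b → M r s ≈ P r s) →
    (∀ r → M r b ≈ a * N r b + e * P r b) →
    detℕ n M ≈ a * detℕ n N + e * detℕ n P
  detℕ-linear (suc n) {M} {N} {P} b a e b<n M≈N M≈P Mb≈ = begin
    ΣN (suc n) (term M)                             ≈⟨ ΣN-cong (suc n) split ⟩
    ΣN (suc n) (λ j → a * term N j + e * term P j)  ≈⟨ ΣN-+ (suc n) (λ j → a * term N j) (λ j → e * term P j) ⟩
    ΣN (suc n) (λ j → a * term N j) + ΣN (suc n) (λ j → e * term P j)
                                                    ≈⟨ +-cong (ΣN-*ˡ (suc n) a (term N)) (ΣN-*ˡ (suc n) e (term P)) ⟩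
    a * detℕ (suc n) N + e * detℕ (suc n) P         ∎
    where
    term : Matrix → ℕ → Carrier
    term K j = sgn j * (K 0 j * detℕ n (minor j K))
    split : ∀ j → j < suc n → term M j ≈ a * term N j + e * term P j
    split j j<n with j ℕ.≟ b
    ... | yes ≡.refl = begin
      sgn j * (M 0 j * detℕ n (minor j M))
        ≈⟨ *-congˡ (*-congʳ (Mb≈ 0)) ⟩
      sgn j * ((a * N 0 j + e * P 0 j) * detℕ n (minor j M))
        ≈⟨ solve 6 (λ s a x e y d → s :* ((a :* x :+ e :* y) :* d) := a :* (s :* (x :* d)) :+ e :* (s :* (y :* d)))
                   refl _ _ _ _ _ _ ⟩
      a * (sgn j * (N 0 j * detℕ n (minor j M))) + e * (sgn j * (P 0 j * detℕ n (minor j M)))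
        ≈⟨ +-cong (*-congˡ (*-congˡ (*-congˡ (detℕ-cong n λ r s _ _ → M≈N (suc r) _ (punchInℕᵢ≢i j s)))))
                  (*-congˡ (*-congˡ (*-congˡ (detℕ-cong n λ r s _ _ → M≈P (suc r) _ (punchInℕᵢ≢i j s))))) ⟩
      a * term N j + e * term P j ∎
    ... | no j≢b = begin
      sgn j * (M 0 j * detℕ n (minor j M))
        ≈⟨ *-congˡ (*-congˡ minor-linear) ⟩
      sgn j * (M 0 j * (a * detℕ n (minor j N) + e * detℕ n (minor j P)))
        ≈⟨ solve 6 (λ s a x e A B → s :* (x :* (a :* A :+ e :* B)) := a :* (s :* (x :* A)) :+ e :* (s :* (x :* B)))
                   refl _ _ _ _ _ _ ⟩
      a * (sgn j * (M 0 j * detℕ n (minor j N))) + e * (sgn j * (M 0 j * detℕ n (minor j P)))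
        ≈⟨ +-cong (*-congˡ (*-congˡ (*-congʳ (M≈N 0 j j≢b)))) (*-congˡ (*-congˡ (*-congʳ (M≈P 0 j j≢b)))) ⟩
      a * term N j + e * term P j ∎
      where
      b′ = punchOutℕ j b
      j[b′]≡b = punchInℕ-punchOutℕ j≢b
      avoids-b : ∀ s → s ≢ b′ → punchInℕ j s ≢ b
      avoids-b s s≢b′ eq = punchInℕ-≢ j s≢b′ (≡.trans eq (≡.sym j[b′]≡b))
      minor-linear = detℕ-linear n b′ a e (punchOutℕ-< j<n b<n j≢b)
        (λ r s s≢b′ → M≈N (suc r) _ (avoids-b s s≢b′))
        (λ r s s≢b′ → M≈P (suc r) _ (avoids-b s s≢b′))
        (λ r → ≡.subst (λ k → M (suc r) k ≈ a * N (suc r) k + e * P (suc r) k) (≡.sym j[b′]≡b) (Mb≈ (suc r)))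

  detℕ-adjacent-equal : ∀ n {M : Matrix} b → suc b < n → (∀ r → M r b ≈ M r (suc b)) → detℕ n M ≈ 0#
  detℕ-adjacent-equal (suc n) {M} b b+1<n Mb≈Mb+1 = begin
    ΣN (suc n) term        ≈⟨ ΣN-cong-pair (suc n) b b+1<n off-pair pair-cancels ⟩
    ΣN (suc n) (λ _ → 0#)  ≈⟨ ΣN-0 (suc n) _ (λ _ _ → refl) ⟩
    0#                     ∎
    where
    term : ℕ → Carrier
    term j = sgn j * (M 0 j * detℕ n (minor j M))
    off-pair : ∀ j → j < suc n → j ≢ b → j ≢ suc b → term j ≈ 0#
    off-pair j j<n j≢b j≢b+1 = begin
      sgn j * (M 0 j * detℕ n (minor j M)) ≈⟨ *-congˡ (*-congˡ minor-vanishes) ⟩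
      sgn j * (M 0 j * 0#)                 ≈⟨ trans (*-congˡ (zeroʳ _)) (zeroʳ _) ⟩
      0#                                   ∎
      where
      minor-vanishes = detℕ-adjacent-equal n (punchOutℕ j b) (suc-punchOutℕ-< j<n b+1<n j≢b j≢b+1)
        λ r → ≡.subst₂ (λ k k′ → M (suc r) k ≈ M (suc r) k′)
                       (≡.sym (punchInℕ-punchOutℕ j≢b)) (≡.sym (punchInℕ-suc-punchOutℕ j≢b j≢b+1))
                       (Mb≈Mb+1 (suc r))
    same-minor : detℕ n (minor b M) ≈ detℕ n (minor (suc b) M)
    same-minor = detℕ-cong n λ r s _ _ → entry r s
      where
      entry : ∀ r s → M (suc r) (punchInℕ b s) ≈ M (suc r) (punchInℕ (suc b) s)
      entry r s with s ℕ.≟ b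
      ... | yes ≡.refl = ≡.subst₂ (λ k k′ → M (suc r) k ≈ M (suc r) k′)
                           (≡.sym (punchInℕ-diag s)) (≡.sym (punchInℕ-subdiag s)) (sym (Mb≈Mb+1 (suc r)))
      ... | no s≢b = reflexive (≡.cong (M (suc r)) (punchInℕ-step s≢b))
    pair-cancels : term b + term (suc b) ≈ 0# + 0#
    pair-cancels = begin
      sgn b * (M 0 b * detℕ n (minor b M)) + - sgn b * (M 0 (suc b) * detℕ n (minor (suc b) M))
        ≈⟨ +-congˡ (*-congˡ (*-cong (sym (Mb≈Mb+1 0)) (sym same-minor))) ⟩
      sgn b * (M 0 b * detℕ n (minor b M)) + - sgn b * (M 0 b * detℕ n (minor b M))
        ≈⟨ solve 2 (λ s x → s :* x :+ (:- s) :* x := con (+ 0) :+ con (+ 0)) refl _ _ ⟩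
      0# + 0# ∎

  detℕ-swap-adjacent : ∀ n {M N : Matrix} b → suc b < n →
    (∀ r s → s ≢ b → s ≢ suc b → N r s ≈ M r s) →
    (∀ r → N r b ≈ M r (suc b)) → (∀ r → N r (suc b) ≈ M r b) →
    detℕ n N ≈ - detℕ n M
  detℕ-swap-adjacent (suc n) {M} {N} b b+1<n N≈M Nb≈ Nb+1≈ = begin
    ΣN (suc n) (term N)              ≈⟨ ΣN-cong-pair (suc n) b b+1<n off-pair pair-swaps ⟩
    ΣN (suc n) (λ j → - term M j)    ≈⟨ ΣN-‿ (suc n) (term M) ⟩
    - ΣN (suc n) (term M)            ∎
    where
    term : Matrix → ℕ → Carrier
    term K j = sgn j * (K 0 j * detℕ n (minor j K))
    off-pair : ∀ j → j < suc n → j ≢ b → j ≢ suc b → term N j ≈ - term M j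
    off-pair j j<n j≢b j≢b+1 = begin
      sgn j * (N 0 j * detℕ n (minor j N))   ≈⟨ *-congˡ (*-cong (N≈M 0 j j≢b j≢b+1) minor-swaps) ⟩
      sgn j * (M 0 j * - detℕ n (minor j M)) ≈⟨ solve 3 (λ s x d → s :* (x :* (:- d)) := :- (s :* (x :* d))) refl _ _ _ ⟩
      - term M j                             ∎
      where
      j[b′]≡b   = punchInℕ-punchOutℕ j≢b
      j[b′+1]≡b+1 = punchInℕ-suc-punchOutℕ j≢b j≢b+1
      minor-swaps = detℕ-swap-adjacent n (punchOutℕ j b) (suc-punchOutℕ-< j<n b+1<n j≢b j≢b+1)
        (λ r s s≢b′ s≢b′+1 → N≈M (suc r) _ (λ eq → punchInℕ-≢ j s≢b′ (≡.trans eq (≡.sym j[b′]≡b)))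
                                             (λ eq → punchInℕ-≢ j s≢b′+1 (≡.trans eq (≡.sym j[b′+1]≡b+1))))
        (λ r → ≡.subst₂ (λ k k′ → N (suc r) k ≈ M (suc r) k′) (≡.sym j[b′]≡b) (≡.sym j[b′+1]≡b+1) (Nb≈ (suc r)))
        (λ r → ≡.subst₂ (λ k k′ → N (suc r) k ≈ M (suc r) k′) (≡.sym j[b′+1]≡b+1) (≡.sym j[b′]≡b) (Nb+1≈ (suc r)))
    minor-b : detℕ n (minor b N) ≈ detℕ n (minor (suc b) M)
    minor-b = detℕ-cong n λ r s _ _ → entry r s
      where
      entry : ∀ r s → N (suc r) (punchInℕ b s) ≈ M (suc r) (punchInℕ (suc b) s)
      entry r s with s ℕ.≟ b
      ... | yes ≡.refl = ≡.subst₂ (λ k k′ → N (suc r) k ≈ M (suc r) k′)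
                           (≡.sym (punchInℕ-diag s)) (≡.sym (punchInℕ-subdiag s)) (Nb+1≈ (suc r))
      ... | no s≢b = trans (N≈M (suc r) _ (punchInℕᵢ≢i b s) (punchInℕ-≢-diag s≢b))
                           (reflexive (≡.cong (M (suc r)) (punchInℕ-step s≢b)))
    minor-b+1 : detℕ n (minor (suc b) N) ≈ detℕ n (minor b M)
    minor-b+1 = detℕ-cong n λ r s _ _ → entry r s
      where
      entry : ∀ r s → N (suc r) (punchInℕ (suc b) s) ≈ M (suc r) (punchInℕ b s)
      entry r s with s ℕ.≟ b
      ... | yes ≡.refl = ≡.subst₂ (λ k k′ → N (suc r) k ≈ M (suc r) k′)
                           (≡.sym (punchInℕ-subdiag s)) (≡.sym (punchInℕ-diag s)) (Nb≈ (suc r))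
      ... | no s≢b = trans (N≈M (suc r) _ (punchInℕ-≢-subdiag s≢b) (punchInℕᵢ≢i (suc b) s))
                           (reflexive (≡.cong (M (suc r)) (≡.sym (punchInℕ-step s≢b))))
    pair-swaps : term N b + term N (suc b) ≈ - term M b + - term M (suc b)
    pair-swaps = begin
      sgn b * (N 0 b * detℕ n (minor b N)) + - sgn b * (N 0 (suc b) * detℕ n (minor (suc b) N))
        ≈⟨ +-cong (*-congˡ (*-cong (Nb≈ 0) minor-b)) (*-congˡ (*-cong (Nb+1≈ 0) minor-b+1)) ⟩
      sgn b * (M 0 (suc b) * detℕ n (minor (suc b) M)) + - sgn b * (M 0 b * detℕ n (minor b M))
        ≈⟨ solve 5 (λ s y B x A → s :* (y :* B) :+ (:- s) :* (x :* A) := :- (s :* (x :* A)) :+ :- ((:- s) :* (y :* B)))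
                   refl _ _ _ _ _ ⟩
      - term M b + - term M (suc b) ∎

  swapColumns : ℕ → Matrix → Matrix
  swapColumns b M r s with s ℕ.≟ b | s ℕ.≟ suc b
  ... | yes _ | _     = M r (suc b)
  ... | no _  | yes _ = M r b
  ... | no _  | no _  = M r s

  swapColumns-b : ∀ b M r → swapColumns b M r b ≡ M r (suc b)
  swapColumns-b b M r with b ℕ.≟ b
  ... | yes _  = ≡.refl
  ... | no b≢b = ⊥-elim (b≢b ≡.refl)

  swapColumns-b+1 : ∀ b M r → swapColumns b M r (suc b) ≡ M r b
  swapColumns-b+1 b M r with suc b ℕ.≟ b | suc b ℕ.≟ suc b
  ... | yes eq | _       = ⊥-elim (ℕP.1+n≢n eq)
  ... | no _   | yes _   = ≡.refl
  ... | no _   | no ne   = ⊥-elim (ne ≡.refl)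

  swapColumns-other : ∀ b M r s → s ≢ b → s ≢ suc b → swapColumns b M r s ≡ M r s
  swapColumns-other b M r s s≢b s≢b+1 with s ℕ.≟ b | s ℕ.≟ suc b
  ... | yes eq | _      = ⊥-elim (s≢b eq)
  ... | no _   | yes eq = ⊥-elim (s≢b+1 eq)
  ... | no _   | no _   = ≡.refl

  private
    detℕ-equal-columns-apart : ∀ d n {M : Matrix} a → a ℕ.+ suc d < n →
                               (∀ r → M r a ≈ M r (a ℕ.+ suc d)) → detℕ n M ≈ 0#
    detℕ-equal-columns-apart zero n {M} a a+1<n Ma≈ =
      detℕ-adjacent-equal n a (≡.subst (_< n) a+1≡1+a a+1<n) (λ r → ≡.subst (λ k → M r a ≈ M r k) a+1≡1+a (Ma≈ r))
      where a+1≡1+a = ℕP.+-comm a 1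
    detℕ-equal-columns-apart (suc d) n {M} a a+d+2<n Ma≈ = begin
      detℕ n M             ≈⟨ sym (-‿involutive _) ⟩
      - (- detℕ n M)       ≈⟨ -‿cong (sym swapped) ⟩
      - detℕ n N           ≈⟨ -‿cong (detℕ-equal-columns-apart d n a (ℕP.<-trans (ℕP.n<1+n b) b+1<n) Na≈Nb) ⟩
      - 0#                 ≈⟨ -0#≈0# ⟩
      0#                   ∎
      where
      b = a ℕ.+ suc d
      a+d+2≡b+1 = ℕP.+-suc a (suc d)
      b+1<n = ≡.subst (_< n) a+d+2≡b+1 a+d+2<n
      N = swapColumns b M
      a≢b : a ≢ b
      a≢b eq = ℕP.m≢1+m+n a (≡.trans eq (ℕP.+-suc a d))
      swapped : detℕ n N ≈ - detℕ n M
      swapped = detℕ-swap-adjacent n b b+1<n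
        (λ r s s≢b s≢b+1 → reflexive (swapColumns-other b M r s s≢b s≢b+1))
        (λ r → reflexive (swapColumns-b b M r)) (λ r → reflexive (swapColumns-b+1 b M r))
      Na≈Nb : ∀ r → N r a ≈ N r b
      Na≈Nb r = begin
        N r a                      ≡⟨ swapColumns-other b M r a a≢b (ℕP.m≢1+m+n a) ⟩
        M r a                      ≈⟨ Ma≈ r ⟩
        M r (a ℕ.+ suc (suc d))    ≡⟨ ≡.cong (M r) a+d+2≡b+1 ⟩
        M r (suc b)                ≡⟨ ≡.sym (swapColumns-b b M r) ⟩
        N r b                      ∎

  detℕ-equal-columns : ∀ n {M : Matrix} a b → a < n → b < n → a ≢ b → (∀ r → M r a ≈ M r b) → detℕ n M ≈ 0#
  detℕ-equal-columns n {M} a b a<n b<n a≢b Ma≈Mb with ℕP.<-cmp a b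
  ... | tri≈ _ a≡b _ = ⊥-elim (a≢b a≡b)
  ... | tri< a<b _ _ with ℕP.m≤n⇒∃[o]m+o≡n a<b
  ...   | d , ≡.refl = detℕ-equal-columns-apart d n a b<n′ (λ r → ≡.subst (λ k → M r a ≈ M r k) a+1+d≡ (Ma≈Mb r))
    where a+1+d≡ = ≡.sym (ℕP.+-suc a d)
          b<n′ = ≡.subst (_< n) a+1+d≡ b<n
  detℕ-equal-columns n {M} a b a<n b<n a≢b Ma≈Mb | tri> _ _ b<a with ℕP.m≤n⇒∃[o]m+o≡n b<a
  ...   | d , ≡.refl = detℕ-equal-columns-apart d n b a<n′ (λ r → ≡.subst (λ k → M r b ≈ M r k) b+1+d≡ (sym (Ma≈Mb r)))
    where b+1+d≡ = ≡.sym (ℕP.+-suc b d)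
          a<n′ = ≡.subst (_< n) b+1+d≡ a<n

  replaceColumn : ℕ → (ℕ → Carrier) → Matrix → Matrix
  replaceColumn b v M r s with s ℕ.≟ b
  ... | yes _ = v r
  ... | no _  = M r s

  replaceColumn-b : ∀ b v M r → replaceColumn b v M r b ≡ v r
  replaceColumn-b b v M r with b ℕ.≟ b
  ... | yes _  = ≡.refl
  ... | no b≢b = ⊥-elim (b≢b ≡.refl)

  replaceColumn-other : ∀ b v M r s → s ≢ b → replaceColumn b v M r s ≡ M r s
  replaceColumn-other b v M r s s≢b with s ℕ.≟ b
  ... | yes eq = ⊥-elim (s≢b eq)
  ... | no _   = ≡.refl

  detℕ-scale-column : ∀ n {M N : Matrix} b d → b < n →
    (∀ r s → s ≢ b → M r s ≈ N r s) → (∀ r → M r b ≈ d * N r b) → detℕ n M ≈ d * detℕ n N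
  detℕ-scale-column n {M} {N} b d b<n M≈N Mb≈ = begin
    detℕ n M                          ≈⟨ detℕ-linear n b d 0# b<n M≈N M≈N (λ r → trans (Mb≈ r) (sym (drop (N r b)))) ⟩
    d * detℕ n N + 0# * detℕ n N     ≈⟨ drop (detℕ n N) ⟩
    d * detℕ n N                     ∎
    where
    drop : ∀ x → d * x + 0# * x ≈ d * x
    drop x = trans (+-congˡ (zeroˡ x)) (+-identityʳ _)

  detℕ-add-multiple : ∀ n {M N : Matrix} a b μ → a < n → b < n → a ≢ b →
    (∀ r s → s ≢ b → M r s ≈ N r s) → (∀ r → M r b ≈ N r b + μ * N r a) → detℕ n M ≈ detℕ n N
  detℕ-add-multiple n {M} {N} a b μ a<n b<n a≢b M≈N Mb≈ = begin
    detℕ n M                        ≈⟨ detℕ-linear n b 1# μ b<n M≈N M≈P Mb≈N+μP ⟩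
    1# * detℕ n N + μ * detℕ n P    ≈⟨ +-cong (*-identityˡ _) (*-congˡ P-degenerate) ⟩
    detℕ n N + μ * 0#               ≈⟨ trans (+-congˡ (zeroʳ μ)) (+-identityʳ _) ⟩
    detℕ n N                        ∎
    where
    P = replaceColumn b (λ r → N r a) N
    M≈P : ∀ r s → s ≢ b → M r s ≈ P r s
    M≈P r s s≢b = trans (M≈N r s s≢b) (reflexive (≡.sym (replaceColumn-other b _ N r s s≢b)))
    Mb≈N+μP : ∀ r → M r b ≈ 1# * N r b + μ * P r b
    Mb≈N+μP r = trans (Mb≈ r) (+-cong (sym (*-identityˡ _)) (*-congˡ (reflexive (≡.sym (replaceColumn-b b _ N r)))))
    P-degenerate : detℕ n P ≈ 0#
    P-degenerate = detℕ-equal-columns n a b a<n b<n a≢b λ r →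
      reflexive (≡.trans (replaceColumn-other b _ N r a a≢b) (≡.sym (replaceColumn-b b _ N r)))

  detℕ-column-combination : ∀ t n {M N : Matrix} b (a : ℕ → ℕ) (κ : ℕ → Carrier) d → b < n →
    (∀ j → j < t → a j < n) → (∀ j → j < t → a j ≢ b) →
    (∀ r s → s ≢ b → M r s ≈ N r s) →
    (∀ r → M r b ≈ ΣN t (λ j → κ j * N r (a j)) + d * N r b) →
    detℕ n M ≈ d * detℕ n N
  detℕ-column-combination zero n b a κ d b<n _ _ M≈N Mb≈ =
    detℕ-scale-column n b d b<n M≈N (λ r → trans (Mb≈ r) (+-identityˡ _))
  detℕ-column-combination (suc t) n {M} {N} b a κ d b<n a<n a≢b M≈N Mb≈ = begin
    detℕ n M    ≈⟨ detℕ-add-multiple n (a t) b (κ t) (a<n t t<t+1) b<n (a≢b t t<t+1) M≈M′ Mb≈M′b+κM′a ⟩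
    detℕ n M′   ≈⟨ detℕ-column-combination t n b a κ d b<n (λ j j<t → a<n j (ℕP.m<n⇒m<1+n j<t))
                     (λ j j<t → a≢b j (ℕP.m<n⇒m<1+n j<t)) M′≈N (λ r → reflexive (replaceColumn-b b column M r)) ⟩
    d * detℕ n N ∎
    where
    t<t+1 = ℕP.n<1+n t
    column : ℕ → Carrier
    column r = ΣN t (λ j → κ j * N r (a j)) + d * N r b
    M′ = replaceColumn b column M
    M≈M′ : ∀ r s → s ≢ b → M r s ≈ M′ r s
    M≈M′ r s s≢b = reflexive (≡.sym (replaceColumn-other b column M r s s≢b))
    M′≈N : ∀ r s → s ≢ b → M′ r s ≈ N r s
    M′≈N r s s≢b = trans (reflexive (replaceColumn-other b column M r s s≢b)) (M≈N r s s≢b)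
    Mb≈M′b+κM′a : ∀ r → M r b ≈ M′ r b + κ t * M′ r (a t)
    Mb≈M′b+κM′a r = begin
      M r b                                                         ≈⟨ Mb≈ r ⟩
      ΣN (suc t) (λ j → κ j * N r (a j)) + d * N r b               ≈⟨ +-congʳ (ΣN-last t _) ⟩
      (ΣN t (λ j → κ j * N r (a j)) + κ t * N r (a t)) + d * N r b
        ≈⟨ solve 3 (λ s u v → (s :+ u) :+ v := (s :+ v) :+ u) refl _ _ _ ⟩
      column r + κ t * N r (a t)
        ≈⟨ +-cong (reflexive (≡.sym (replaceColumn-b b column M r))) (*-congˡ (sym (M′≈N r (a t) (a≢b t t<t+1)))) ⟩
      M′ r b + κ t * M′ r (a t)                                     ∎

  detℕ-first-row : ∀ n (M : Matrix) → (∀ j → M 0 (suc j) ≈ 0#) → detℕ (suc n) M ≈ M 0 0 * detℕ n (minor 0 M)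
  detℕ-first-row n M M0≈0 = begin
    1# * (M 0 0 * detℕ n (minor 0 M)) + ΣN n (λ i → sgn (suc i) * (M 0 (suc i) * detℕ n (minor (suc i) M)))
      ≈⟨ +-cong (*-identityˡ _) (ΣN-0 n _ λ i _ → trans (*-congˡ (trans (*-congʳ (M0≈0 i)) (zeroˡ _))) (zeroʳ _)) ⟩
    M 0 0 * detℕ n (minor 0 M) + 0#
      ≈⟨ +-identityʳ _ ⟩
    M 0 0 * detℕ n (minor 0 M) ∎

  private
    ΠN-punchIn : ∀ n j (f : ℕ → Carrier) → j ≤ n → ΠN (suc n) f ≈ f j * ΠN n (λ s → f (punchInℕ j s))
    ΠN-punchIn n       zero    f _         = refl
    ΠN-punchIn (suc n) (suc j) f (s≤s j≤n) = begin
      f 0 * ΠN (suc n) (λ i → f (suc i))                          ≈⟨ *-congˡ (ΠN-punchIn n j (λ i → f (suc i)) j≤n) ⟩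
      f 0 * (f (suc j) * ΠN n (λ s → f (suc (punchInℕ j s))))     ≈⟨ x∙yz≈y∙xz _ _ _ ⟩
      f (suc j) * (f 0 * ΠN n (λ s → f (suc (punchInℕ j s))))     ∎
      where open import Algebra.Properties.CommutativeSemigroup *-commutativeSemigroup using (x∙yz≈y∙xz)

  detℕ-scale-columns : ∀ n (d : ℕ → Carrier) (K : Matrix) → detℕ n (λ r s → d s * K r s) ≈ ΠN n d * detℕ n K
  detℕ-scale-columns zero    d K = sym (*-identityˡ 1#)
  detℕ-scale-columns (suc n) d K = begin
    ΣN (suc n) (λ j → sgn j * ((d j * K 0 j) * detℕ n (λ r s → d (punchInℕ j s) * K (suc r) (punchInℕ j s))))
      ≈⟨ ΣN-cong (suc n) term ⟩
    ΣN (suc n) (λ j → ΠN (suc n) d * (sgn j * (K 0 j * detℕ n (minor j K))))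
      ≈⟨ ΣN-*ˡ (suc n) (ΠN (suc n) d) (λ j → sgn j * (K 0 j * detℕ n (minor j K))) ⟩
    ΠN (suc n) d * detℕ (suc n) K ∎
    where
    term : ∀ j → j < suc n → sgn j * ((d j * K 0 j) * detℕ n (λ r s → d (punchInℕ j s) * K (suc r) (punchInℕ j s)))
                            ≈ ΠN (suc n) d * (sgn j * (K 0 j * detℕ n (minor j K)))
    term j (s≤s j≤n) = begin
      sgn j * ((d j * K 0 j) * detℕ n (λ r s → d (punchInℕ j s) * K (suc r) (punchInℕ j s)))
        ≈⟨ *-congˡ (*-congˡ (detℕ-scale-columns n (λ s → d (punchInℕ j s)) (minor j K))) ⟩
      sgn j * ((d j * K 0 j) * (ΠN n (λ s → d (punchInℕ j s)) * detℕ n (minor j K)))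
        ≈⟨ solve 5 (λ s x k p D → s :* ((x :* k) :* (p :* D)) := (x :* p) :* (s :* (k :* D))) refl _ _ _ _ _ ⟩
      (d j * ΠN n (λ s → d (punchInℕ j s))) * (sgn j * (K 0 j * detℕ n (minor j K)))
        ≈⟨ *-congʳ (sym (ΠN-punchIn n j d j≤n)) ⟩
      ΠN (suc n) d * (sgn j * (K 0 j * detℕ n (minor j K))) ∎

  addFirstColumn : (ℕ → Carrier) → Matrix → Matrix
  addFirstColumn f M r zero    = M r zero
  addFirstColumn f M r (suc s) = M r (suc s) + f s * M r zero

  private
    addFirstColumnBelow : ℕ → (ℕ → Carrier) → Matrix → Matrix
    addFirstColumnBelow t f M r zero = M r zero
    addFirstColumnBelow t f M r (suc s) with s ℕ.<? t
    ... | yes _ = M r (suc s) + f s * M r zero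
    ... | no _  = M r (suc s)

    detℕ-addFirstColumnBelow : ∀ n t f M → t ≤ n → detℕ (suc n) (addFirstColumnBelow t f M) ≈ detℕ (suc n) M
    detℕ-addFirstColumnBelow n zero f M _ = detℕ-cong (suc n) λ r s _ _ → unchanged r s
      where
      unchanged : ∀ r s → addFirstColumnBelow 0 f M r s ≈ M r s
      unchanged r zero    = refl
      unchanged r (suc s) = refl
    detℕ-addFirstColumnBelow n (suc t) f M t<n = begin
      detℕ (suc n) (addFirstColumnBelow (suc t) f M)
        ≈⟨ detℕ-add-multiple (suc n) 0 (suc t) (f t) (s≤s z≤n) (s≤s t<n) (λ ()) others column-t+1 ⟩
      detℕ (suc n) (addFirstColumnBelow t f M)
        ≈⟨ detℕ-addFirstColumnBelow n t f M (ℕP.<⇒≤ t<n) ⟩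
      detℕ (suc n) M ∎
      where
      others : ∀ r s → s ≢ suc t → addFirstColumnBelow (suc t) f M r s ≈ addFirstColumnBelow t f M r s
      others r zero    _ = refl
      others r (suc s) s+1≢t+1 with s ℕ.<? suc t | s ℕ.<? t
      ... | yes _    | yes _   = refl
      ... | no _     | no _    = refl
      ... | yes s<t+1 | no s≮t = ⊥-elim (s≮t (ℕP.≤∧≢⇒< (ℕP.≤-pred s<t+1) (s+1≢t+1 ∘ ≡.cong suc)))
      ... | no s≮t+1 | yes s<t = ⊥-elim (s≮t+1 (ℕP.m<n⇒m<1+n s<t))
      column-t+1 : ∀ r → addFirstColumnBelow (suc t) f M r (suc t)
                         ≈ addFirstColumnBelow t f M r (suc t) + f t * addFirstColumnBelow t f M r 0
      column-t+1 r with t ℕ.<? suc t | t ℕ.<? t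
      ... | yes _   | no _    = refl
      ... | no t≮t+1 | _      = ⊥-elim (t≮t+1 (ℕP.n<1+n t))
      ... | _       | yes t<t = ⊥-elim (ℕP.n≮n t t<t)

  detℕ-addFirstColumn : ∀ n (f : ℕ → Carrier) (M : Matrix) → detℕ (suc n) (addFirstColumn f M) ≈ detℕ (suc n) M
  detℕ-addFirstColumn n f M = begin
    detℕ (suc n) (addFirstColumn f M)          ≈⟨ detℕ-cong (suc n) (λ r s _ → agree r s) ⟩
    detℕ (suc n) (addFirstColumnBelow n f M)   ≈⟨ detℕ-addFirstColumnBelow n n f M ℕP.≤-refl ⟩
    detℕ (suc n) M                             ∎
    where
    agree : ∀ r s → s < suc n → addFirstColumn f M r s ≈ addFirstColumnBelow n f M r s
    agree r zero    _ = refl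
    agree r (suc s) (s≤s s<n) with s ℕ.<? n
    ... | yes _   = refl
    ... | no s≮n = ⊥-elim (s≮n s<n)

module Vandermonde {c r : Level} (R : CommutativeRing c r) where
  open RingToolkit R
  open Determinant R

  completeHomogeneous : List Carrier → ℕ → Carrier
  completeHomogeneous []      zero    = 1#
  completeHomogeneous []      (suc k) = 0#
  completeHomogeneous (x ∷ Z) zero    = 1#
  completeHomogeneous (x ∷ Z) (suc k) = x * completeHomogeneous (x ∷ Z) k + completeHomogeneous Z (suc k)

  private
    h = completeHomogeneous

    h-singleton : ∀ x k → h (x ∷ []) k ≈ x ^ℕ k
    h-singleton x zero    = refl
    h-singleton x (suc k) = trans (+-identityʳ _) (*-congˡ (h-singleton x k))

    h-difference : ∀ Z a b k → h (a ∷ Z) (suc k) + - h (b ∷ Z) (suc k) ≈ (a + - b) * h (a ∷ b ∷ Z) k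
    h-difference Z a b zero =
      solve 3 (λ a b g → (a :* con (+ 1) :+ g) :- (b :* con (+ 1) :+ g) := (a :- b) :* con (+ 1)) refl a b (h Z 1)
    h-difference Z a b (suc k) = begin
      (a * A + g) + - (b * B + g)            ≈⟨ +-congʳ (+-congʳ (*-congˡ A≈)) ⟩
      (a * ((a + - b) * W + B) + g) + - (b * B + g)
        ≈⟨ solve 5 (λ a b W B g → (a :* ((a :- b) :* W :+ B) :+ g) :- (b :* B :+ g) := (a :- b) :* (a :* W :+ B))
                   refl a b W B g ⟩
      (a + - b) * (a * W + B)                ∎
      where
      A = h (a ∷ Z) (suc k)
      B = h (b ∷ Z) (suc k)
      W = h (a ∷ b ∷ Z) k
      g = h Z (suc (suc k))
      A≈ : A ≈ (a + - b) * W + B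
      A≈ = begin
        A                  ≈⟨ solve 2 (λ A B → A := (A :- B) :+ B) refl A B ⟩
        (A + - B) + B      ≈⟨ +-congʳ (h-difference Z a b k) ⟩
        (a + - b) * W + B  ∎

  vandermondeProduct : ℕ → (ℕ → Carrier) → Carrier
  vandermondeProduct zero    y = 1#
  vandermondeProduct (suc n) y = ΠN n (λ b → y (suc b) + - y 0) * vandermondeProduct n (λ i → y (suc i))

  private
    -- Subtracting column 0 from the others, h-difference factors y s - y 0 out of column s and
    -- leaves h_r in one more variable, with first row (1, 0, …, 0).
    detℕ-h : ∀ n Z (y : ℕ → Carrier) → detℕ n (λ r s → h (y s ∷ Z) r) ≈ vandermondeProduct n y
    detℕ-h zero    Z y = refl
    detℕ-h (suc n) Z y = begin
      detℕ (suc n) M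
        ≈⟨ sym (detℕ-addFirstColumn n (λ _ → - 1#) M) ⟩
      detℕ (suc n) (addFirstColumn (λ _ → - 1#) M)
        ≈⟨ detℕ-first-row n (addFirstColumn (λ _ → - 1#) M) (λ _ → 1-1≈0) ⟩
      1# * detℕ n (λ r s → h (y (suc s) ∷ Z) (suc r) + - 1# * h (y 0 ∷ Z) (suc r))
        ≈⟨ trans (*-identityˡ _) (detℕ-cong n λ r s _ _ → trans (solve 2 (λ u v → u :+ con -[1+ 0 ] :* v := u :- v) refl _ _)
                                                                 (h-difference Z (y (suc s)) (y 0) r)) ⟩
      detℕ n (λ r s → (y (suc s) + - y 0) * h (y (suc s) ∷ y 0 ∷ Z) r)
        ≈⟨ detℕ-scale-columns n (λ s → y (suc s) + - y 0) (λ r s → h (y (suc s) ∷ y 0 ∷ Z) r) ⟩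
      ΠN n (λ s → y (suc s) + - y 0) * detℕ n (λ r s → h (y (suc s) ∷ y 0 ∷ Z) r)
        ≈⟨ *-congˡ (detℕ-h n (y 0 ∷ Z) (λ i → y (suc i))) ⟩
      vandermondeProduct (suc n) y ∎
      where
      M = λ r s → h (y s ∷ Z) r
      1-1≈0 : 1# + - 1# * 1# ≈ 0#
      1-1≈0 = solve 0 (con (+ 1) :+ con -[1+ 0 ] :* con (+ 1) := con (+ 0)) refl

  vandermonde : ∀ n (y : ℕ → Carrier) → detℕ n (λ r s → y s ^ℕ r) ≈ vandermondeProduct n y
  vandermonde n y = trans (detℕ-cong n λ r s _ _ → sym (h-singleton (y s) r)) (detℕ-h n [] y)

  vandermondeProduct-cong : ∀ n {y z : ℕ → Carrier} → (∀ i → i < n → y i ≈ z i) →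
                            vandermondeProduct n y ≈ vandermondeProduct n z
  vandermondeProduct-cong zero    y≈z = refl
  vandermondeProduct-cong (suc n) y≈z =
    *-cong (ΠN-cong n λ b b<n → +-cong (y≈z (suc b) (s≤s b<n)) (-‿cong (y≈z 0 (s≤s z≤n))))
           (vandermondeProduct-cong n λ i i<n → y≈z (suc i) (s≤s i<n))

  vandermondeProduct-split : ∀ a b (y : ℕ → Carrier) → vandermondeProduct (a ℕ.+ b) y ≈
    (vandermondeProduct a y * vandermondeProduct b (λ i → y (a ℕ.+ i))) * ΠN a (λ s → ΠN b (λ t → y (a ℕ.+ t) + - y s))
  vandermondeProduct-split zero    b y = sym (trans (*-identityʳ _) (*-identityˡ _))
  vandermondeProduct-split (suc a) b y = begin
    ΠN (a ℕ.+ b) (λ j → y (suc j) + - y 0) * vandermondeProduct (a ℕ.+ b) (λ i → y (suc i))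
      ≈⟨ *-cong (ΠN-split a b _) (vandermondeProduct-split a b _) ⟩
    (ΠN a (λ j → y (suc j) + - y 0) * ΠN b (λ t → y (suc (a ℕ.+ t)) + - y 0)) *
      ((vandermondeProduct a (λ i → y (suc i)) * vandermondeProduct b (λ i → y (suc (a ℕ.+ i)))) *
       ΠN a (λ s → ΠN b (λ t → y (suc (a ℕ.+ t)) + - y (suc s))))
      ≈⟨ solve 5 (λ p₁ p₂ v₁ v₂ p₃ → (p₁ :* p₂) :* ((v₁ :* v₂) :* p₃) := ((p₁ :* v₁) :* v₂) :* (p₂ :* p₃)) refl _ _ _ _ _ ⟩
    ((ΠN a (λ j → y (suc j) + - y 0) * vandermondeProduct a (λ i → y (suc i))) *
      vandermondeProduct b (λ i → y (suc (a ℕ.+ i)))) *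
      (ΠN b (λ t → y (suc (a ℕ.+ t)) + - y 0) * ΠN a (λ s → ΠN b (λ t → y (suc (a ℕ.+ t)) + - y (suc s)))) ∎

  vandermondeProduct-last : ∀ n (y : ℕ → Carrier) →
    vandermondeProduct (suc n) y ≈ vandermondeProduct n y * ΠN n (λ s → y n + - y s)
  vandermondeProduct-last n y = begin
    vandermondeProduct (suc n) y     ≡⟨ ≡.cong (λ k → vandermondeProduct k y) (ℕP.+-comm 1 n) ⟩
    vandermondeProduct (n ℕ.+ 1) y   ≈⟨ vandermondeProduct-split n 1 y ⟩
    (vandermondeProduct n y * (1# * 1#)) * ΠN n (λ s → (y (n ℕ.+ 0) + - y s) * 1#)
      ≈⟨ *-cong (trans (*-congˡ (*-identityˡ _)) (*-identityʳ _))
                (ΠN-cong n λ s _ → trans (*-identityʳ _) (+-congʳ (reflexive (≡.cong y (ℕP.+-identityʳ n))))) ⟩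
    vandermondeProduct n y * ΠN n (λ s → y n + - y s) ∎

module LinearFactorProduct {c r : Level} (R : CommutativeRing c r) (u v : ℕ → CommutativeRing.Carrier R) where
  open RingToolkit R

  -- coeff k j is the coefficient of z^j in ∏_{t < k} (u t + v t · z).
  coeff : ℕ → ℕ → Carrier
  coeff zero    zero    = 1#
  coeff zero    (suc j) = 0#
  coeff (suc k) zero    = coeff k 0 * u k
  coeff (suc k) (suc j) = coeff k (suc j) * u k + coeff k j * v k

  coeff-vanishes : ∀ k j → k < j → coeff k j ≈ 0#
  coeff-vanishes zero    (suc j) _         = refl
  coeff-vanishes (suc k) (suc j) (s≤s k<j) = begin
    coeff k (suc j) * u k + coeff k j * v k ≈⟨ +-cong (*-congʳ (coeff-vanishes k (suc j) (ℕP.m<n⇒m<1+n k<j)))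
                                                     (*-congʳ (coeff-vanishes k j k<j)) ⟩
    0# * u k + 0# * v k                     ≈⟨ trans (+-cong (zeroˡ _) (zeroˡ _)) (+-identityʳ 0#) ⟩
    0#                                      ∎

  coeff-leading : ∀ k → coeff k k ≈ ΠN k v
  coeff-leading zero    = refl
  coeff-leading (suc k) = begin
    coeff k (suc k) * u k + coeff k k * v k ≈⟨ +-cong (*-congʳ (coeff-vanishes k (suc k) (ℕP.n<1+n k))) (*-congʳ (coeff-leading k)) ⟩
    0# * u k + ΠN k v * v k                 ≈⟨ trans (+-congʳ (zeroˡ _)) (+-identityˡ _) ⟩
    ΠN k v * v k                            ≈⟨ sym (ΠN-last k v) ⟩
    ΠN (suc k) v                            ∎

  ΠN-expand : ∀ k z → ΠN k (λ t → u t + v t * z) ≈ ΣN (suc k) (λ j → coeff k j * z ^ℕ j)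
  ΠN-expand zero    z = solve 0 (con (+ 1) := con (+ 1) :* con (+ 1) :+ con (+ 0)) refl
  ΠN-expand (suc k) z = begin
    ΠN (suc k) (λ t → u t + v t * z)                    ≈⟨ ΠN-last k _ ⟩
    ΠN k (λ t → u t + v t * z) * (u k + v k * z)        ≈⟨ *-congʳ (ΠN-expand k z) ⟩
    S * (u k + v k * z)                                 ≈⟨ distribˡ S _ _ ⟩
    S * u k + S * (v k * z)                             ≈⟨ +-cong (sym (ΣN-*ʳ (suc k) (u k) E)) (sym (ΣN-*ʳ (suc k) (v k * z) E)) ⟩
    (E 0 * u k + ΣN k (λ j → E (suc j) * u k)) + ΣN (suc k) (λ j → E j * (v k * z))
      ≈⟨ +-congʳ (+-congˡ top-term-vanishes) ⟩
    (E 0 * u k + ΣN (suc k) (λ j → E (suc j) * u k)) + ΣN (suc k) (λ j → E j * (v k * z))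
      ≈⟨ +-assoc _ _ _ ⟩
    E 0 * u k + (ΣN (suc k) (λ j → E (suc j) * u k) + ΣN (suc k) (λ j → E j * (v k * z)))
      ≈⟨ +-congˡ (sym (ΣN-+ (suc k) (λ j → E (suc j) * u k) (λ j → E j * (v k * z)))) ⟩
    E 0 * u k + ΣN (suc k) (λ j → E (suc j) * u k + E j * (v k * z))
      ≈⟨ +-cong (solve 2 (λ e u → e :* con (+ 1) :* u := e :* u :* con (+ 1)) refl (coeff k 0) (u k))
                (ΣN-cong (suc k) λ j _ →
                   solve 6 (λ e₁ e₀ u v z zʲ → e₁ :* (z :* zʲ) :* u :+ e₀ :* zʲ :* (v :* z) := (e₁ :* u :+ e₀ :* v) :* (z :* zʲ))
                           refl (coeff k (suc j)) (coeff k j) (u k) (v k) z (z ^ℕ j)) ⟩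
    ΣN (suc (suc k)) (λ j → coeff (suc k) j * z ^ℕ j)   ∎
    where
    E = λ j → coeff k j * z ^ℕ j
    S = ΣN (suc k) E
    top-term-vanishes : ΣN k (λ j → E (suc j) * u k) ≈ ΣN (suc k) (λ j → E (suc j) * u k)
    top-term-vanishes = sym (begin
      ΣN (suc k) (λ j → E (suc j) * u k)      ≈⟨ ΣN-last k _ ⟩
      ΣN k (λ j → E (suc j) * u k) + E (suc k) * u k
        ≈⟨ +-congˡ (trans (*-congʳ (trans (*-congʳ (coeff-vanishes k (suc k) (ℕP.n<1+n k))) (zeroˡ _))) (zeroˡ _)) ⟩
      ΣN k (λ j → E (suc j) * u k) + 0#       ≈⟨ +-identityʳ _ ⟩
      ΣN k (λ j → E (suc j) * u k)            ∎)

module Locate where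

  inBlock : ∀ {ℓ} → Maybe (Fin ℓ × ℕ) → Maybe (Fin (suc ℓ) × ℕ)
  inBlock = Maybe.map (Prod.map₁ F.suc)

  blockStart : ∀ ℓ → (Fin ℓ → ℕ) → Fin ℓ → ℕ
  blockStart (suc ℓ) m F.zero    = 0
  blockStart (suc ℓ) m (F.suc i) = m F.zero ℕ.+ blockStart ℓ (m ∘ F.suc) i

  locate-first : ∀ ℓ (m : Fin (suc ℓ) → ℕ) c → c < m F.zero → locate (suc ℓ) m c ≡ just (F.zero , c)
  locate-first ℓ m c c<m₀ with c ℕ.<? m F.zero
  ... | yes _    = ≡.refl
  ... | no c≮m₀ = ⊥-elim (c≮m₀ c<m₀)

  locate-rest : ∀ ℓ (m : Fin (suc ℓ) → ℕ) c → ¬ c < m F.zero →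
                locate (suc ℓ) m c ≡ inBlock (locate ℓ (m ∘ F.suc) (c ∸ m F.zero))
  locate-rest ℓ m c c≮m₀ with c ℕ.<? m F.zero
  ... | yes c<m₀ = ⊥-elim (c≮m₀ c<m₀)
  ... | no _ with locate ℓ (m ∘ F.suc) (c ∸ m F.zero)
  ...   | just _  = ≡.refl
  ...   | nothing = ≡.refl

  locate-shift : ∀ ℓ (m : Fin (suc ℓ) → ℕ) p → locate (suc ℓ) m (m F.zero ℕ.+ p) ≡ inBlock (locate ℓ (m ∘ F.suc) p)
  locate-shift ℓ m p = ≡.trans (locate-rest ℓ m _ (ℕP.≤⇒≯ (ℕP.m≤m+n (m F.zero) p)))
                               (≡.cong (inBlock ∘ locate ℓ (m ∘ F.suc)) (ℕP.m+n∸m≡n (m F.zero) p))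

  locate-blockStart : ∀ ℓ (m : Fin ℓ → ℕ) i k → k < m i → locate ℓ m (blockStart ℓ m i ℕ.+ k) ≡ just (i , k)
  locate-blockStart (suc ℓ) m F.zero    k k<mᵢ = locate-first ℓ m k k<mᵢ
  locate-blockStart (suc ℓ) m (F.suc i) k k<mᵢ = begin
    locate (suc ℓ) m ((m F.zero ℕ.+ blockStart ℓ (m ∘ F.suc) i) ℕ.+ k)
      ≡⟨ ≡.cong (locate (suc ℓ) m) (ℕP.+-assoc (m F.zero) _ k) ⟩
    locate (suc ℓ) m (m F.zero ℕ.+ (blockStart ℓ (m ∘ F.suc) i ℕ.+ k))
      ≡⟨ locate-shift ℓ m _ ⟩
    inBlock (locate ℓ (m ∘ F.suc) (blockStart ℓ (m ∘ F.suc) i ℕ.+ k))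
      ≡⟨ ≡.cong inBlock (locate-blockStart ℓ (m ∘ F.suc) i k k<mᵢ) ⟩
    just (F.suc i , k) ∎
    where open ≡.≡-Reasoning

  locate-just⁻¹ : ∀ ℓ (m : Fin ℓ → ℕ) c {i k} → locate ℓ m c ≡ just (i , k) → c ≡ blockStart ℓ m i ℕ.+ k × k < m i
  locate-just⁻¹ (suc ℓ) m c eq with c ℕ.<? m F.zero
  locate-just⁻¹ (suc ℓ) m c ≡.refl | yes c<m₀ = ≡.refl , c<m₀
  ... | no c≮m₀ with locate ℓ (m ∘ F.suc) (c ∸ m F.zero) in eq′
  locate-just⁻¹ (suc ℓ) m c ≡.refl | no c≮m₀ | just (i , k) with locate-just⁻¹ ℓ (m ∘ F.suc) (c ∸ m F.zero) eq′
  ... | c-m₀≡ , k<mᵢ = ≡.trans (≡.sym (ℕP.m+[n∸m]≡n (ℕP.≮⇒≥ c≮m₀)))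
                               (≡.trans (≡.cong (m F.zero ℕ.+_) c-m₀≡) (≡.sym (ℕP.+-assoc (m F.zero) _ k))) , k<mᵢ

  locate-nothing⁻¹ : ∀ ℓ (m : Fin ℓ → ℕ) c → c < sumℕ ℓ m → locate ℓ m c ≢ nothing
  locate-nothing⁻¹ (suc ℓ) m c c<Σm eq with c ℕ.<? m F.zero
  locate-nothing⁻¹ (suc ℓ) m c c<Σm () | yes _
  ... | no c≮m₀ with locate ℓ (m ∘ F.suc) (c ∸ m F.zero) in eq′
  locate-nothing⁻¹ (suc ℓ) m c c<Σm () | no c≮m₀ | just _
  ... | nothing = locate-nothing⁻¹ ℓ (m ∘ F.suc) (c ∸ m F.zero)
        (≡.subst (c ∸ m F.zero <_) (ℕP.m+n∸m≡n (m F.zero) _) (ℕP.∸-monoˡ-< c<Σm (ℕP.≮⇒≥ c≮m₀))) eq′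

  module _ {a} {A : Set a} where

    byColumn : ∀ ℓ → (Fin ℓ → ℕ) → (Fin ℓ → ℕ → A) → A → ℕ → A
    byColumn ℓ m f default s = Maybe.maybe (Prod.uncurry f) default (locate ℓ m s)

    byColumn-first : ∀ ℓ (m : Fin (suc ℓ) → ℕ) f default p → p < m F.zero → byColumn (suc ℓ) m f default p ≡ f F.zero p
    byColumn-first ℓ m f default p p<m₀ = ≡.cong (Maybe.maybe (Prod.uncurry f) default) (locate-first ℓ m p p<m₀)

    byColumn-shift : ∀ ℓ (m : Fin (suc ℓ) → ℕ) f default p →
                     byColumn (suc ℓ) m f default (m F.zero ℕ.+ p) ≡ byColumn ℓ (m ∘ F.suc) (f ∘ F.suc) default p
    byColumn-shift ℓ m f default p
      rewrite locate-shift ℓ m p with locate ℓ (m ∘ F.suc) p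
    ... | just _  = ≡.refl
    ... | nothing = ≡.refl

module BlockMatrix {c r : Level} (R : CommutativeRing c r) (q qi w Q : CommutativeRing.Carrier R) where
  open RingToolkit R
  open QNotation q qi w Q
  open Determinant R
  open Vandermonde R
  open Locate

  -- [C + r - t]_q = w + slope t · q^r
  slope : ℕ → Carrier
  slope t = - ((w * Q) * qi ^ℕ t)

  open LinearFactorProduct R (λ _ → w) slope public

  module _ (q*qi≈1 : q * qi ≈ 1#) where

    qC-linear : ∀ r t → qC (+ r ℤ.- + t) ≈ w + slope t * q ^ℕ r
    qC-linear r t = begin
      (1# + - (Q * zpow q qi (+ r ℤ.- + t))) * w  ≈⟨ *-congʳ (+-congˡ (-‿cong (*-congˡ (zpow-⊖ q*qi≈1 r t)))) ⟩
      (1# + - (Q * (qi ^ℕ t * q ^ℕ r))) * w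
        ≈⟨ solve 4 (λ Q u v w → (con (+ 1) :- Q :* (u :* v)) :* w := w :+ (:- (w :* Q :* u)) :* v) refl Q (qi ^ℕ t) (q ^ℕ r) w ⟩
      w + slope t * q ^ℕ r                        ∎

    entryA-expand : ∀ {X Xi} → X * Xi ≈ 1# → ∀ r k →
                    entryA X Xi r k ≈ ΣN (suc k) (λ j → (Xi ^ℕ k * coeff k j) * (q ^ℕ j * X) ^ℕ r)
    entryA-expand {X} {Xi} X*Xi≈1 r k = begin
      prodR k (λ i → qC (+ r ℤ.- + toℕ i)) * zpow X Xi (+ r ℤ.- + k)
        ≈⟨ *-cong (prodR≈ΠN k (qC-linear r ∘ toℕ)) (zpow-⊖ X*Xi≈1 r k) ⟩
      ΠN k (λ t → w + slope t * q ^ℕ r) * (Xi ^ℕ k * X ^ℕ r)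
        ≈⟨ *-congʳ (ΠN-expand k (q ^ℕ r)) ⟩
      ΣN (suc k) (λ j → coeff k j * (q ^ℕ r) ^ℕ j) * (Xi ^ℕ k * X ^ℕ r)
        ≈⟨ sym (ΣN-*ʳ (suc k) (Xi ^ℕ k * X ^ℕ r) (λ j → coeff k j * (q ^ℕ r) ^ℕ j)) ⟩
      ΣN (suc k) (λ j → (coeff k j * (q ^ℕ r) ^ℕ j) * (Xi ^ℕ k * X ^ℕ r))
        ≈⟨ ΣN-cong (suc k) (λ j _ → term j) ⟩
      ΣN (suc k) (λ j → (Xi ^ℕ k * coeff k j) * (q ^ℕ j * X) ^ℕ r) ∎
      where
      term : ∀ j → (coeff k j * (q ^ℕ r) ^ℕ j) * (Xi ^ℕ k * X ^ℕ r) ≈ (Xi ^ℕ k * coeff k j) * (q ^ℕ j * X) ^ℕ r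
      term j = begin
        (coeff k j * (q ^ℕ r) ^ℕ j) * (Xi ^ℕ k * X ^ℕ r)  ≈⟨ *-congʳ (*-congˡ (^ℕ-comm q r j)) ⟩
        (coeff k j * (q ^ℕ j) ^ℕ r) * (Xi ^ℕ k * X ^ℕ r)
          ≈⟨ solve 4 (λ e u x v → (e :* u) :* (x :* v) := (x :* e) :* (u :* v)) refl _ _ _ _ ⟩
        (Xi ^ℕ k * coeff k j) * ((q ^ℕ j) ^ℕ r * X ^ℕ r)  ≈⟨ *-congˡ (sym (^ℕ-distrib-* (q ^ℕ j) X r)) ⟩
        (Xi ^ℕ k * coeff k j) * (q ^ℕ j * X) ^ℕ r         ∎

  module _ (ℓ : ℕ) (m : Fin ℓ → ℕ) (X Xi : Fin ℓ → Carrier) where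

    node : ℕ → Carrier
    node = byColumn ℓ m (λ i k → q ^ℕ k * X i) 0#

    pivot : ℕ → Carrier
    pivot = byColumn ℓ m (λ i k → Xi i ^ℕ k * coeff k k) 1#

    entry : Matrix
    entry r = byColumn ℓ m (λ i k → entryA (X i) (Xi i) r k) 0#

    det-blockMatrix : det (sumℕ ℓ m) (blockMatrix (sumℕ ℓ m) ℓ m X Xi) ≈ detℕ (sumℕ ℓ m) entry
    det-blockMatrix = det≈detℕ (sumℕ ℓ m) λ r s → agree r s
      where
      agree : ∀ r s → blockMatrix (sumℕ ℓ m) ℓ m X Xi r s ≈ entry (toℕ r) (toℕ s)
      agree r s with locate ℓ m (toℕ s)
      ... | just _  = refl
      ... | nothing = refl

    module _ (q*qi≈1 : q * qi ≈ 1#) (X*Xi≈1 : ∀ i → X i * Xi i ≈ 1#) where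
      private
        n = sumℕ ℓ m

        reduced : ℕ → Matrix
        reduced p r s with s ℕ.<? p
        ... | yes _ = node s ^ℕ r
        ... | no _  = entry r s

        reduced-< : ∀ {p s} r → s < p → reduced p r s ≡ node s ^ℕ r
        reduced-< {p} {s} r s<p with s ℕ.<? p
        ... | yes _   = ≡.refl
        ... | no s≮p = ⊥-elim (s≮p s<p)

        reduced-≮ : ∀ {p s} r → ¬ s < p → reduced p r s ≡ entry r s
        reduced-≮ {p} {s} r s≮p with s ℕ.<? p
        ... | yes s<p = ⊥-elim (s≮p s<p)
        ... | no _    = ≡.refl

        reduced-other : ∀ {p s} r → s ≢ p → reduced (suc p) r s ≡ reduced p r s
        reduced-other {p} {s} r s≢p with s ℕ.<? p
        ... | yes s<p = reduced-< r (ℕP.m<n⇒m<1+n s<p)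
        ... | no s≮p  = reduced-≮ r λ s<p+1 → s≮p (ℕP.≤∧≢⇒< (ℕP.≤-pred s<p+1) s≢p)

        det-reduce-column : ∀ p → p < n → detℕ n (reduced p) ≈ pivot p * detℕ n (reduced (suc p))
        det-reduce-column p p<n with locate ℓ m p in locate-p
        ... | nothing = ⊥-elim (locate-nothing⁻¹ ℓ m p p<n locate-p)
        ... | just (i , k) with locate-just⁻¹ ℓ m p locate-p
        ...   | p≡ , k<mᵢ = begin
          detℕ n (reduced p)              ≈⟨ detℕ-column-combination k n p (s₀ ℕ.+_) κ (κ k) p<n a<n a≢p
                                               (λ r s s≢p → reflexive (≡.sym (reduced-other r s≢p))) column-p ⟩
          κ k * detℕ n (reduced (suc p))  ∎
          where
          s₀ = blockStart ℓ m i
          κ : ℕ → Carrier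
          κ j = Xi i ^ℕ k * coeff k j
          s₀+j<p : ∀ j → j < k → s₀ ℕ.+ j < p
          s₀+j<p j j<k = ≡.subst (s₀ ℕ.+ j <_) (≡.sym p≡) (ℕP.+-monoʳ-< s₀ j<k)
          a<n : ∀ j → j < k → s₀ ℕ.+ j < n
          a<n j j<k = ℕP.<-trans (s₀+j<p j j<k) p<n
          a≢p : ∀ j → j < k → s₀ ℕ.+ j ≢ p
          a≢p j j<k = ℕP.<⇒≢ (s₀+j<p j j<k)
          node-at : ∀ j → j < m i → node (s₀ ℕ.+ j) ≡ q ^ℕ j * X i
          node-at j j<mᵢ = ≡.cong (Maybe.maybe _ 0#) (locate-blockStart ℓ m i j j<mᵢ)
          column-p : ∀ r → reduced p r p ≈ ΣN k (λ j → κ j * reduced (suc p) r (s₀ ℕ.+ j)) + κ k * reduced (suc p) r p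
          column-p r = begin
            reduced p r p                  ≡⟨ ≡.trans (reduced-≮ r (ℕP.n≮n p)) (≡.cong (Maybe.maybe _ 0#) locate-p) ⟩
            entryA (X i) (Xi i) r k        ≈⟨ entryA-expand q*qi≈1 (X*Xi≈1 i) r k ⟩
            ΣN (suc k) (λ j → κ j * (q ^ℕ j * X i) ^ℕ r)
                                           ≈⟨ ΣN-last k _ ⟩
            ΣN k (λ j → κ j * (q ^ℕ j * X i) ^ℕ r) + κ k * (q ^ℕ k * X i) ^ℕ r
              ≈⟨ +-cong (ΣN-cong k λ j j<k → *-congˡ (reflexive (≡.sym (node-column j j<k))))
                        (*-congˡ (reflexive (≡.sym (≡.trans (reduced-< r (ℕP.n<1+n p))
                                                      (≡.cong (λ x → Maybe.maybe _ 0# x ^ℕ r) locate-p))))) ⟩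
            ΣN k (λ j → κ j * reduced (suc p) r (s₀ ℕ.+ j)) + κ k * reduced (suc p) r p ∎
            where
            node-column : ∀ j → j < k → reduced (suc p) r (s₀ ℕ.+ j) ≡ (q ^ℕ j * X i) ^ℕ r
            node-column j j<k = ≡.trans (reduced-< r (ℕP.m<n⇒m<1+n (s₀+j<p j j<k)))
                                        (≡.cong (_^ℕ r) (node-at j (ℕP.<-trans j<k k<mᵢ)))

        det-reduce : ∀ p → p ≤ n → detℕ n entry ≈ ΠN p pivot * detℕ n (reduced p)
        det-reduce zero    _     =
          trans (detℕ-cong n λ r s _ _ → reflexive (≡.sym (reduced-≮ {0} r λ ()))) (sym (*-identityˡ _))
        det-reduce (suc p) p<n = begin
          detℕ n entry                                   ≈⟨ det-reduce p (ℕP.<⇒≤ p<n) ⟩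
          ΠN p pivot * detℕ n (reduced p)                ≈⟨ *-congˡ (det-reduce-column p p<n) ⟩
          ΠN p pivot * (pivot p * detℕ n (reduced (suc p))) ≈⟨ sym (*-assoc _ _ _) ⟩
          (ΠN p pivot * pivot p) * detℕ n (reduced (suc p)) ≈⟨ *-congʳ (sym (ΠN-last p pivot)) ⟩
          ΠN (suc p) pivot * detℕ n (reduced (suc p))    ∎

      detℕ-entry : detℕ n entry ≈ ΠN n pivot * vandermondeProduct n node
      detℕ-entry = begin
        detℕ n entry                                  ≈⟨ det-reduce n ℕP.≤-refl ⟩
        ΠN n pivot * detℕ n (reduced n)               ≈⟨ *-congˡ (detℕ-cong n λ r s _ s<n → reflexive (reduced-< r s<n)) ⟩
        ΠN n pivot * detℕ n (λ r s → node s ^ℕ r)     ≈⟨ *-congˡ (vandermonde n node) ⟩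
        ΠN n pivot * vandermondeProduct n node        ∎

module Exponent where
  open import Data.Integer.Solver using (module +-*-Solver)
  open +-*-Solver using (solve; _:=_; _:+_; _:-_)
  open ≡.≡-Reasoning

  Σℕ-id : ∀ m → Σℕ m (λ s → s) ≡ m C 2
  Σℕ-id zero    = ≡.refl
  Σℕ-id (suc m) = begin
    Σℕ (suc m) (λ s → s)    ≡⟨ Σℕ-last m (λ s → s) ⟩
    Σℕ m (λ s → s) ℕ.+ m    ≡⟨ ≡.cong₂ ℕ._+_ (Σℕ-id m) (≡.sym (nC1≡n m)) ⟩
    m C 2 ℕ.+ m C 1         ≡⟨ ℕP.+-comm (m C 2) _ ⟩
    m C 1 ℕ.+ m C 2         ≡⟨ nCk+nC[k+1]≡[n+1]C[k+1] m 1 ⟩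
    suc m C 2               ∎

  Σℕ-reverse : ∀ m → Σℕ m (λ j → m ∸ suc j) ≡ m C 2
  Σℕ-reverse zero    = ≡.refl
  Σℕ-reverse (suc m) = begin
    m ℕ.+ Σℕ m (λ j → m ∸ suc j) ≡⟨ ≡.cong₂ ℕ._+_ (≡.sym (nC1≡n m)) (Σℕ-reverse m) ⟩
    m C 1 ℕ.+ m C 2              ≡⟨ nCk+nC[k+1]≡[n+1]C[k+1] m 1 ⟩
    suc m C 2                    ∎

  Σℕ-j*[m-j-1] : ∀ m → Σℕ m (λ j → j ℕ.* (m ∸ suc j)) ≡ m C 3
  Σℕ-j*[m-j-1] zero    = ≡.refl
  Σℕ-j*[m-j-1] (suc m) = begin
    Σℕ (suc m) (λ j → j ℕ.* (m ∸ j))                       ≡⟨ Σℕ-last m _ ⟩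
    Σℕ m (λ j → j ℕ.* (m ∸ j)) ℕ.+ m ℕ.* (m ∸ m)           ≡⟨ ≡.cong (Σℕ m (λ j → j ℕ.* (m ∸ j)) ℕ.+_) m*[m∸m]≡0 ⟩
    Σℕ m (λ j → j ℕ.* (m ∸ j)) ℕ.+ 0                       ≡⟨ ℕP.+-identityʳ _ ⟩
    Σℕ m (λ j → j ℕ.* (m ∸ j))                             ≡⟨ Σℕ-cong m split ⟩
    Σℕ m (λ j → j ℕ.* (m ∸ suc j) ℕ.+ j)                   ≡⟨ Σℕ-+ m _ _ ⟩
    Σℕ m (λ j → j ℕ.* (m ∸ suc j)) ℕ.+ Σℕ m (λ j → j)      ≡⟨ ≡.cong₂ ℕ._+_ (Σℕ-j*[m-j-1] m) (Σℕ-id m) ⟩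
    m C 3 ℕ.+ m C 2                                        ≡⟨ ℕP.+-comm (m C 3) _ ⟩
    m C 2 ℕ.+ m C 3                                        ≡⟨ nCk+nC[k+1]≡[n+1]C[k+1] m 2 ⟩
    suc m C 3                                              ∎
    where
    m*[m∸m]≡0 = ≡.trans (≡.cong (m ℕ.*_) (ℕP.n∸n≡0 m)) (ℕP.*-zeroʳ m)
    split : ∀ j → j < m → j ℕ.* (m ∸ j) ≡ j ℕ.* (m ∸ suc j) ℕ.+ j
    split j j<m = begin
      j ℕ.* (m ∸ j)                ≡⟨ ≡.cong (j ℕ.*_) (ℕP.+-∸-assoc 1 j<m) ⟩
      j ℕ.* suc (m ∸ suc j)        ≡⟨ ℕP.*-suc j _ ⟩
      j ℕ.+ j ℕ.* (m ∸ suc j)      ≡⟨ ℕP.+-comm j _ ⟩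
      j ℕ.* (m ∸ suc j) ℕ.+ j      ∎

  sumℕ≡Σℕ : ∀ n {f : Fin n → ℕ} {g : ℕ → ℕ} → (∀ j → f j ≡ g (toℕ j)) → sumℕ n f ≡ Σℕ n g
  sumℕ≡Σℕ zero    f≡g = ≡.refl
  sumℕ≡Σℕ (suc n) f≡g = ≡.cong₂ ℕ._+_ (f≡g F.zero) (sumℕ≡Σℕ n (f≡g ∘ F.suc))

  sumℕ-cong : ∀ n {f g : Fin n → ℕ} → (∀ j → f j ≡ g j) → sumℕ n f ≡ sumℕ n g
  sumℕ-cong zero    f≡g = ≡.refl
  sumℕ-cong (suc n) f≡g = ≡.cong₂ ℕ._+_ (f≡g F.zero) (sumℕ-cong n (f≡g ∘ F.suc))

  sumℕ-*ˡ : ∀ n c (f : Fin n → ℕ) → sumℕ n (λ i → c ℕ.* f i) ≡ c ℕ.* sumℕ n f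
  sumℕ-*ˡ zero    c f = ≡.sym (ℕP.*-zeroʳ c)
  sumℕ-*ˡ (suc n) c f = ≡.trans (≡.cong (c ℕ.* f F.zero ℕ.+_) (sumℕ-*ˡ n c _)) (≡.sym (ℕP.*-distribˡ-+ c (f F.zero) _))

  sumℤ-cong : ∀ n {f g : Fin n → ℤ} → (∀ j → f j ≡ g j) → sumℤ n f ≡ sumℤ n g
  sumℤ-cong zero    f≡g = ≡.refl
  sumℤ-cong (suc n) f≡g = ≡.cong₂ ℤ._+_ (f≡g F.zero) (sumℤ-cong n (f≡g ∘ F.suc))

  sumℤ-+ : ∀ n (f : Fin n → ℕ) → sumℤ n (λ i → + f i) ≡ + sumℕ n f
  sumℤ-+ zero    f = ≡.refl
  sumℤ-+ (suc n) f = ≡.cong (λ z → + f F.zero ℤ.+ z) (sumℤ-+ n _)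

  sumℤ-- : ∀ n (f g : Fin n → ℤ) → sumℤ n (λ i → f i ℤ.- g i) ≡ sumℤ n f ℤ.- sumℤ n g
  sumℤ-- zero    f g = ≡.refl
  sumℤ-- (suc n) f g = ≡.trans (≡.cong (λ z → (f F.zero ℤ.- g F.zero) ℤ.+ z) (sumℤ-- n _ _))
    (solve 4 (λ a b c d → (a :- b) :+ (c :- d) := (a :+ c) :- (b :+ d)) ≡.refl (f F.zero) (g F.zero) _ _)

  -- Σ_{i < j} binom(m_i, 2) m_j, which is N₁ without its multiple of C.
  qExponent : ∀ ℓ → (Fin ℓ → ℕ) → ℕ
  qExponent zero    m = 0
  qExponent (suc ℓ) m = Σℕ (m F.zero) (λ s → s) ℕ.* sumℕ ℓ (m ∘ F.suc) ℕ.+ qExponent ℓ (m ∘ F.suc)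

  private
    blockTerm : ∀ mᵢ b → sumℤ mᵢ (λ j → (+ (suc (toℕ j) ℕ.+ b) ℤ.- + 1) ℤ.* + (mᵢ ∸ suc (toℕ j))) ℤ.- + (mᵢ C 3)
                         ≡ + (b ℕ.* (mᵢ C 2))
    blockTerm mᵢ b = begin
      sumℤ mᵢ (λ j → (+ (suc (toℕ j) ℕ.+ b) ℤ.- + 1) ℤ.* + (mᵢ ∸ suc (toℕ j))) ℤ.- + (mᵢ C 3)
        ≡⟨ ≡.cong (ℤ._- + (mᵢ C 3)) (≡.trans (sumℤ-cong mᵢ λ j → ≡.sym (ℤP.pos-* (toℕ j ℕ.+ b) _)) (sumℤ-+ mᵢ _)) ⟩
      + sumℕ mᵢ (λ j → (toℕ j ℕ.+ b) ℕ.* (mᵢ ∸ suc (toℕ j))) ℤ.- + (mᵢ C 3)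
        ≡⟨ ≡.cong (λ z → + z ℤ.- + (mᵢ C 3)) inner ⟩
      + (mᵢ C 3 ℕ.+ b ℕ.* (mᵢ C 2)) ℤ.- + (mᵢ C 3)
        ≡⟨ solve 2 (λ a c → (a :+ c) :- a := c) ≡.refl (+ (mᵢ C 3)) (+ (b ℕ.* (mᵢ C 2))) ⟩
      + (b ℕ.* (mᵢ C 2)) ∎
      where
      inner : sumℕ mᵢ (λ j → (toℕ j ℕ.+ b) ℕ.* (mᵢ ∸ suc (toℕ j))) ≡ mᵢ C 3 ℕ.+ b ℕ.* (mᵢ C 2)
      inner = begin
        sumℕ mᵢ (λ j → (toℕ j ℕ.+ b) ℕ.* (mᵢ ∸ suc (toℕ j)))
          ≡⟨ sumℕ≡Σℕ mᵢ (λ _ → ≡.refl) ⟩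
        Σℕ mᵢ (λ j → (j ℕ.+ b) ℕ.* (mᵢ ∸ suc j))
          ≡⟨ Σℕ-cong mᵢ (λ j _ → ℕP.*-distribʳ-+ (mᵢ ∸ suc j) j b) ⟩
        Σℕ mᵢ (λ j → j ℕ.* (mᵢ ∸ suc j) ℕ.+ b ℕ.* (mᵢ ∸ suc j))
          ≡⟨ Σℕ-+ mᵢ _ _ ⟩
        Σℕ mᵢ (λ j → j ℕ.* (mᵢ ∸ suc j)) ℕ.+ Σℕ mᵢ (λ j → b ℕ.* (mᵢ ∸ suc j))
          ≡⟨ ≡.cong₂ ℕ._+_ (Σℕ-j*[m-j-1] mᵢ) (≡.trans (Σℕ-*ˡ mᵢ b _) (≡.cong (b ℕ.*_) (Σℕ-reverse mᵢ))) ⟩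
        mᵢ C 3 ℕ.+ b ℕ.* (mᵢ C 2) ∎

    beforeWeighted : ∀ ℓ → (Fin ℓ → ℕ) → ℕ
    beforeWeighted ℓ m = sumℕ ℓ (λ i → before m i ℕ.* (m i C 2))

    blockTerms : ∀ ℓ m → sumℤ ℓ (λ i →
        sumℤ (m i) (λ j → (+ (suc (toℕ j) ℕ.+ before m i) ℤ.- + 1) ℤ.* + (m i ∸ suc (toℕ j))) ℤ.- + (m i C 3))
      ≡ + beforeWeighted ℓ m
    blockTerms ℓ m = ≡.trans (sumℤ-cong ℓ λ i → blockTerm (m i) (before m i)) (sumℤ-+ ℓ _)

    beforeWeighted-suc : ∀ ℓ (m : Fin (suc ℓ) → ℕ) →
      beforeWeighted (suc ℓ) m ≡ m F.zero ℕ.* sumℕ ℓ (λ i → m (F.suc i) C 2) ℕ.+ beforeWeighted ℓ (m ∘ F.suc)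
    beforeWeighted-suc ℓ m = begin
      before m F.zero ℕ.* (m₀ C 2) ℕ.+ sumℕ ℓ (λ i → (m₀ ℕ.+ before m′ i) ℕ.* (m′ i C 2))
        ≡⟨ ≡.cong₂ ℕ._+_ (≡.cong (ℕ._* (m₀ C 2)) (sumℕ-zero (suc ℓ)))
                         (sumℕ-cong ℓ λ i → ℕP.*-distribʳ-+ (m′ i C 2) m₀ _) ⟩
      0 ℕ.+ sumℕ ℓ (λ i → m₀ ℕ.* (m′ i C 2) ℕ.+ before m′ i ℕ.* (m′ i C 2))
        ≡⟨ ≡.trans (sumℕ-+ ℓ _ _) (≡.cong (ℕ._+ beforeWeighted ℓ m′) (sumℕ-*ˡ ℓ m₀ _)) ⟩
      m₀ ℕ.* sumℕ ℓ (λ i → m′ i C 2) ℕ.+ beforeWeighted ℓ m′ ∎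
      where
      m₀ = m F.zero
      m′ = m ∘ F.suc
      sumℕ-zero : ∀ n → sumℕ n (λ _ → 0) ≡ 0
      sumℕ-zero zero    = ≡.refl
      sumℕ-zero (suc n) = sumℕ-zero n
      sumℕ-+ : ∀ n (f g : Fin n → ℕ) → sumℕ n (λ i → f i ℕ.+ g i) ≡ sumℕ n f ℕ.+ sumℕ n g
      sumℕ-+ zero    f g = ≡.refl
      sumℕ-+ (suc n) f g = ≡.trans (≡.cong (f F.zero ℕ.+ g F.zero ℕ.+_) (sumℕ-+ n _ _))
                                   (+-interchange (f F.zero) (g F.zero) _ _)
        where open import Algebra.Properties.CommutativeSemigroup ℕP.+-commutativeSemigroup
                renaming (interchange to +-interchange)

    pairTerms : ∀ ℓ → (Fin ℓ → ℕ) → ℤ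
    pairTerms ℓ m = sumℤ ℓ (λ i → sumℤ ℓ (λ j →
      if does (i <? j) then + (m i ℕ.* (m j C 2)) ℤ.- + (m j ℕ.* (m i C 2)) else + 0))

    pairTerms-suc : ∀ ℓ (m : Fin (suc ℓ) → ℕ) → pairTerms (suc ℓ) m ≡
      (+ (m F.zero ℕ.* sumℕ ℓ (λ j → m (F.suc j) C 2)) ℤ.- + ((m F.zero C 2) ℕ.* sumℕ ℓ (m ∘ F.suc)))
        ℤ.+ pairTerms ℓ (m ∘ F.suc)
    pairTerms-suc ℓ m = ≡.cong₂ ℤ._+_ firstRow (sumℤ-cong ℓ λ _ → ℤP.+-identityˡ _)
      where
      m₀ = m F.zero
      m′ = m ∘ F.suc
      firstRow : + 0 ℤ.+ sumℤ ℓ (λ j → + (m₀ ℕ.* (m′ j C 2)) ℤ.- + (m′ j ℕ.* (m₀ C 2)))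
                 ≡ + (m₀ ℕ.* sumℕ ℓ (λ j → m′ j C 2)) ℤ.- + ((m₀ C 2) ℕ.* sumℕ ℓ m′)
      firstRow = begin
        + 0 ℤ.+ sumℤ ℓ (λ j → + (m₀ ℕ.* (m′ j C 2)) ℤ.- + (m′ j ℕ.* (m₀ C 2)))
          ≡⟨ ℤP.+-identityˡ _ ⟩
        sumℤ ℓ (λ j → + (m₀ ℕ.* (m′ j C 2)) ℤ.- + (m′ j ℕ.* (m₀ C 2)))
          ≡⟨ sumℤ-- ℓ _ _ ⟩
        sumℤ ℓ (λ j → + (m₀ ℕ.* (m′ j C 2))) ℤ.- sumℤ ℓ (λ j → + (m′ j ℕ.* (m₀ C 2)))
          ≡⟨ ≡.cong₂ ℤ._-_ (≡.trans (sumℤ-+ ℓ _) (≡.cong +_ (sumℕ-*ˡ ℓ m₀ _)))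
                           (≡.trans (sumℤ-+ ℓ _) (≡.cong +_ (≡.trans (sumℕ-cong ℓ λ j → ℕP.*-comm (m′ j) _)
                                                                     (sumℕ-*ˡ ℓ (m₀ C 2) _)))) ⟩
        + (m₀ ℕ.* sumℕ ℓ (λ j → m′ j C 2)) ℤ.- + ((m₀ C 2) ℕ.* sumℕ ℓ m′) ∎

  N₁const≡qExponent : ∀ ℓ (m : Fin ℓ → ℕ) → N₁const ℓ m ≡ + qExponent ℓ m
  N₁const≡qExponent zero    m = ≡.refl
  N₁const≡qExponent (suc ℓ) m = begin
    N₁const (suc ℓ) m
      ≡⟨ ≡.cong₂ ℤ._-_ (≡.trans (blockTerms (suc ℓ) m) (≡.cong +_ (beforeWeighted-suc ℓ m))) (pairTerms-suc ℓ m) ⟩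
    + (A ℕ.+ beforeWeighted ℓ m′) ℤ.- ((+ A ℤ.- + B) ℤ.+ pairTerms ℓ m′)
      ≡⟨ solve 4 (λ a w b s → (a :+ w) :- ((a :- b) :+ s) := b :+ (w :- s)) ≡.refl
                 (+ A) (+ beforeWeighted ℓ m′) (+ B) (pairTerms ℓ m′) ⟩
    + B ℤ.+ (+ beforeWeighted ℓ m′ ℤ.- pairTerms ℓ m′)
      ≡⟨ ≡.cong (λ z → + B ℤ.+ z)
                (≡.trans (≡.cong (ℤ._- pairTerms ℓ m′) (≡.sym (blockTerms ℓ m′))) (N₁const≡qExponent ℓ m′)) ⟩
    + (B ℕ.+ qExponent ℓ m′)
      ≡⟨ ≡.cong (λ z → + (z ℕ.* sumℕ ℓ m′ ℕ.+ qExponent ℓ m′)) (≡.sym (Σℕ-id (m F.zero))) ⟩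
    + qExponent (suc ℓ) m ∎
    where
    m′ = m ∘ F.suc
    A = m F.zero ℕ.* sumℕ ℓ (λ j → m′ j C 2)
    B = (m F.zero C 2) ℕ.* sumℕ ℓ m′

module ClosedForm {c r : Level} (R : CommutativeRing c r) (q qi w Q : CommutativeRing.Carrier R)
                  (q*qi≈1 : CommutativeRing._≈_ R (CommutativeRing._*_ R q qi) (CommutativeRing.1# R)) where
  open RingToolkit R
  open QNotation q qi w Q
  open Vandermonde R
  open BlockMatrix R q qi w Q
  open Locate
  open Exponent using (qExponent)

  qfactorial : ℕ → Carrier
  qfactorial j = ΠN j (λ t → qnum (suc t))

  qfact≈qfactorial : ∀ j → qfact j ≈ qfactorial j
  qfact≈qfactorial j = prodR≈ΠN j λ _ → refl

  module _ {X Xi : Carrier} (X*Xi≈1 : X * Xi ≈ 1#) where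
    private
      slope-times-gap : ∀ m t → t ≤ m → (Xi * slope t) * (q ^ℕ m * X + - (q ^ℕ t * X)) ≈ Q * qnum (m ∸ t)
      slope-times-gap m t t≤m = begin
        (Xi * slope t) * (q ^ℕ m * X + - (q ^ℕ t * X))
          ≈⟨ *-congˡ (+-congʳ (*-congʳ q^m≈)) ⟩
        (Xi * - ((w * Q) * qi ^ℕ t)) * ((q ^ℕ (m ∸ t) * q ^ℕ t) * X + - (q ^ℕ t * X))
          ≈⟨ solve 7 (λ Xi w Q v d u X → (Xi :* (:- ((w :* Q) :* v))) :* ((d :* u) :* X :- u :* X)
                        := ((v :* u) :* (X :* Xi)) :* (Q :* ((con (+ 1) :- d) :* w)))
                     refl Xi w Q (qi ^ℕ t) (q ^ℕ (m ∸ t)) (q ^ℕ t) X ⟩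
        ((qi ^ℕ t * q ^ℕ t) * (X * Xi)) * (Q * qnum (m ∸ t))
          ≈⟨ *-congʳ (trans (*-cong (xi^n*x^n≈1 q*qi≈1 t) X*Xi≈1) (*-identityˡ _)) ⟩
        1# * (Q * qnum (m ∸ t))
          ≈⟨ *-identityˡ _ ⟩
        Q * qnum (m ∸ t) ∎
        where
        q^m≈ : q ^ℕ m ≈ q ^ℕ (m ∸ t) * q ^ℕ t
        q^m≈ = trans (reflexive (≡.cong (q ^ℕ_) (≡.sym (ℕP.m∸n+n≡m t≤m)))) (^ℕ-homo-* q (m ∸ t) t)

      pivot-times-gaps : ∀ m → (Xi ^ℕ m * coeff m m) * ΠN m (λ s → q ^ℕ m * X + - (q ^ℕ s * X)) ≈ Q ^ℕ m * qfactorial m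
      pivot-times-gaps m = begin
        (Xi ^ℕ m * coeff m m) * ΠN m gap                     ≈⟨ *-congʳ (*-cong (sym (ΠN-const m Xi)) (coeff-leading m)) ⟩
        (ΠN m (λ _ → Xi) * ΠN m slope) * ΠN m gap            ≈⟨ *-congʳ (sym (ΠN-* m _ _)) ⟩
        ΠN m (λ t → Xi * slope t) * ΠN m gap                 ≈⟨ sym (ΠN-* m _ _) ⟩
        ΠN m (λ t → (Xi * slope t) * gap t)                  ≈⟨ ΠN-cong m (λ t t<m → slope-times-gap m t (ℕP.<⇒≤ t<m)) ⟩
        ΠN m (λ t → Q * qnum (m ∸ t))                        ≈⟨ ΠN-* m _ _ ⟩
        ΠN m (λ _ → Q) * ΠN m (λ t → qnum (m ∸ t))           ≈⟨ *-cong (ΠN-const m Q) (ΠN-reverse m qnum) ⟩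
        Q ^ℕ m * qfactorial m                                ∎
        where
        gap = λ s → q ^ℕ m * X + - (q ^ℕ s * X)

    block-contribution : ∀ m → ΠN m (λ k → Xi ^ℕ k * coeff k k) * vandermondeProduct m (λ k → q ^ℕ k * X)
                               ≈ Q ^ℕ sumℕ m (λ j → m ∸ suc (toℕ j)) * ΠN (m ∸ 1) (λ j → qfactorial (suc j))
    block-contribution zero    = refl
    block-contribution (suc m) = begin
      ΠN (suc m) piv * vandermondeProduct (suc m) nod
        ≈⟨ *-cong (ΠN-last m piv) (vandermondeProduct-last m nod) ⟩
      (ΠN m piv * piv m) * (vandermondeProduct m nod * ΠN m (λ s → nod m + - nod s))
        ≈⟨ solve 4 (λ a b c d → (a :* b) :* (c :* d) := (a :* c) :* (b :* d)) refl _ _ _ _ ⟩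
      (ΠN m piv * vandermondeProduct m nod) * (piv m * ΠN m (λ s → nod m + - nod s))
        ≈⟨ *-cong (block-contribution m) (pivot-times-gaps m) ⟩
      (Q ^ℕ Sb m * ΠN (m ∸ 1) (λ j → qfactorial (suc j))) * (Q ^ℕ m * qfactorial m)
        ≈⟨ solve 4 (λ a b c d → (a :* b) :* (c :* d) := (c :* a) :* (b :* d)) refl _ _ _ _ ⟩
      (Q ^ℕ m * Q ^ℕ Sb m) * (ΠN (m ∸ 1) (λ j → qfactorial (suc j)) * qfactorial m)
        ≈⟨ *-cong (sym (^ℕ-homo-* Q m (Sb m))) (sym (ΠN-qfactorial-last m)) ⟩
      Q ^ℕ (m ℕ.+ Sb m) * ΠN m (λ j → qfactorial (suc j)) ∎
      where
      piv = λ k → Xi ^ℕ k * coeff k k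
      nod = λ k → q ^ℕ k * X
      Sb : ℕ → ℕ
      Sb m = sumℕ m (λ j → m ∸ suc (toℕ j))
      ΠN-qfactorial-last : ∀ m → ΠN m (λ j → qfactorial (suc j)) ≈ ΠN (m ∸ 1) (λ j → qfactorial (suc j)) * qfactorial m
      ΠN-qfactorial-last zero    = sym (*-identityˡ 1#)
      ΠN-qfactorial-last (suc m) = ΠN-last m (λ j → qfactorial (suc j))

  ΠN-node : ∀ ℓ m X Xi (F : Carrier → Carrier) →
    ΠN (sumℕ ℓ m) (λ t → F (node ℓ m X Xi t)) ≈ prodR ℓ (λ j → ΠN (m j) (λ t → F (q ^ℕ t * X j)))
  ΠN-node zero    m X Xi F = refl
  ΠN-node (suc ℓ) m X Xi F = begin
    ΠN (m₀ ℕ.+ sumℕ ℓ m′) (λ t → F (node (suc ℓ) m X Xi t))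
      ≈⟨ ΠN-split m₀ (sumℕ ℓ m′) _ ⟩
    ΠN m₀ (λ t → F (node (suc ℓ) m X Xi t)) * ΠN (sumℕ ℓ m′) (λ t → F (node (suc ℓ) m X Xi (m₀ ℕ.+ t)))
      ≈⟨ *-cong (ΠN-cong m₀ λ t t<m₀ → reflexive (≡.cong F (byColumn-first ℓ m _ 0# t t<m₀)))
                (trans (ΠN-cong (sumℕ ℓ m′) λ t _ → reflexive (≡.cong F (byColumn-shift ℓ m _ 0# t)))
                       (ΠN-node ℓ m′ (X ∘ F.suc) (Xi ∘ F.suc) F)) ⟩
    ΠN m₀ (λ t → F (q ^ℕ t * X F.zero)) * prodR ℓ (λ j → ΠN (m′ j) (λ t → F (q ^ℕ t * X (F.suc j)))) ∎
    where
    m₀ = m F.zero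
    m′ = m ∘ F.suc

  private
    gap-rescale : ∀ s t X X₀ → q ^ℕ t * X + - (q ^ℕ s * X₀) ≈ q ^ℕ s * (zpow q qi (+ t ℤ.- + s) * X + - X₀)
    gap-rescale s t X X₀ = sym (begin
      q ^ℕ s * (zpow q qi (+ t ℤ.- + s) * X + - X₀)     ≈⟨ *-congˡ (+-congʳ (*-congʳ (zpow-⊖ q*qi≈1 t s))) ⟩
      q ^ℕ s * ((qi ^ℕ s * q ^ℕ t) * X + - X₀)
        ≈⟨ solve 5 (λ a b u x y → a :* ((b :* u) :* x :- y) := (a :* b) :* (u :* x) :- a :* y) refl _ _ _ _ _ ⟩
      (q ^ℕ s * qi ^ℕ s) * (q ^ℕ t * X) + - (q ^ℕ s * X₀) ≈⟨ +-congʳ (trans (*-congʳ q^s*qi^s≈1) (*-identityˡ _)) ⟩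
      q ^ℕ t * X + - (q ^ℕ s * X₀)                       ∎)
      where q^s*qi^s≈1 = trans (*-comm _ _) (xi^n*x^n≈1 q*qi≈1 s)

    ΠN-q^s^n : ∀ m₀ n → ΠN m₀ (λ s → (q ^ℕ s) ^ℕ n) ≈ q ^ℕ (Σℕ m₀ (λ s → s) ℕ.* n)
    ΠN-q^s^n m₀ n = begin
      ΠN m₀ (λ s → (q ^ℕ s) ^ℕ n)
        ≈⟨ ΠN-cong m₀ (λ s _ → trans (^ℕ-assocʳ q s n) (reflexive (≡.cong (q ^ℕ_) (ℕP.*-comm s n)))) ⟩
      ΠN m₀ (λ s → q ^ℕ (n ℕ.* s))     ≈⟨ ΠN-^ℕ m₀ q _ ⟩
      q ^ℕ Σℕ m₀ (λ s → n ℕ.* s)       ≡⟨ ≡.cong (q ^ℕ_) (≡.trans (Σℕ-*ˡ m₀ n (λ s → s)) (ℕP.*-comm n _)) ⟩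
      q ^ℕ (Σℕ m₀ (λ s → s) ℕ.* n)     ∎

  cross-terms : ∀ ℓ m X Xi (X₀ : Carrier) (m₀ : ℕ) →
    ΠN m₀ (λ s → ΠN (sumℕ ℓ m) (λ t → node ℓ m X Xi t + - (q ^ℕ s * X₀))) ≈
    q ^ℕ (Σℕ m₀ (λ s → s) ℕ.* sumℕ ℓ m) *
      prodR ℓ (λ j → prodR m₀ (λ s → prodR (m j) (λ t → zpow q qi (+ toℕ t ℤ.- + toℕ s) * X j + - X₀)))
  cross-terms ℓ m X Xi X₀ m₀ = begin
    ΠN m₀ (λ s → ΠN n (λ t → node ℓ m X Xi t + - (q ^ℕ s * X₀)))
      ≈⟨ ΠN-cong m₀ (λ s _ → ΠN-node ℓ m X Xi (λ y → y + - (q ^ℕ s * X₀))) ⟩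
    ΠN m₀ (λ s → prodR ℓ (λ j → ΠN (m j) (λ t → q ^ℕ t * X j + - (q ^ℕ s * X₀))))
      ≈⟨ ΠN-cong m₀ (λ s _ → prodR-cong ℓ λ j → ΠN-cong (m j) λ t _ → gap-rescale s t (X j) X₀) ⟩
    ΠN m₀ (λ s → prodR ℓ (λ j → ΠN (m j) (λ t → q ^ℕ s * g s j t)))
      ≈⟨ ΠN-cong m₀ (λ s _ → trans (prodR-cong ℓ λ j → ΠN-* (m j) _ _) (prodR-* ℓ _ _)) ⟩
    ΠN m₀ (λ s → prodR ℓ (λ j → ΠN (m j) (λ _ → q ^ℕ s)) * prodR ℓ (λ j → ΠN (m j) (g s j)))
      ≈⟨ ΠN-cong m₀ (λ s _ → *-congʳ (trans (prodR-cong ℓ λ j → ΠN-const (m j) (q ^ℕ s)) (prodR-^ℕ ℓ (q ^ℕ s) m))) ⟩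
    ΠN m₀ (λ s → (q ^ℕ s) ^ℕ n * prodR ℓ (λ j → ΠN (m j) (g s j)))
      ≈⟨ ΠN-* m₀ _ _ ⟩
    ΠN m₀ (λ s → (q ^ℕ s) ^ℕ n) * ΠN m₀ (λ s → prodR ℓ (λ j → ΠN (m j) (g s j)))
      ≈⟨ *-cong (ΠN-q^s^n m₀ n) (ΠN-prodR-comm m₀ ℓ (λ s j → ΠN (m j) (g s j))) ⟩
    q ^ℕ (Σℕ m₀ (λ s → s) ℕ.* n) * prodR ℓ (λ j → ΠN m₀ (λ s → ΠN (m j) (g s j)))
      ≈⟨ *-congˡ (prodR-cong ℓ λ j → sym (prodR≈ΠN m₀ λ s → prodR≈ΠN (m j) λ t → refl)) ⟩
    q ^ℕ (Σℕ m₀ (λ s → s) ℕ.* n) *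
      prodR ℓ (λ j → prodR m₀ (λ s → prodR (m j) (λ t → zpow q qi (+ toℕ t ℤ.- + toℕ s) * X j + - X₀))) ∎
    where
    n = sumℕ ℓ m
    g = λ s j t → zpow q qi (+ t ℤ.- + s) * X j + - X₀

  private
    vdmProd-suc : ∀ ℓ (m : Fin (suc ℓ) → ℕ) X → vdmProd (suc ℓ) m X ≈
      prodR ℓ (λ j → prodR (m F.zero) (λ s → prodR (m (F.suc j)) (λ t →
        zpow q qi (+ toℕ t ℤ.- + toℕ s) * X (F.suc j) + - X F.zero)))
      * vdmProd ℓ (m ∘ F.suc) (X ∘ F.suc)
    vdmProd-suc ℓ m X = *-cong (*-identityˡ _) (prodR-cong ℓ λ _ → *-identityˡ _)

    module FirstBlock (ℓ : ℕ) (m : Fin (suc ℓ) → ℕ) (X Xi : Fin (suc ℓ) → Carrier) where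
      m₀ n′ : ℕ
      m₀ = m F.zero
      n′ = sumℕ ℓ (m ∘ F.suc)

      piv nod piv′ nod′ piv₀ nod₀ : ℕ → Carrier
      piv = pivot (suc ℓ) m X Xi
      nod = node (suc ℓ) m X Xi
      piv′ = pivot ℓ (m ∘ F.suc) (X ∘ F.suc) (Xi ∘ F.suc)
      nod′ = node ℓ (m ∘ F.suc) (X ∘ F.suc) (Xi ∘ F.suc)
      piv₀ = λ k → Xi F.zero ^ℕ k * coeff k k
      nod₀ = λ k → q ^ℕ k * X F.zero

      split : ΠN (m₀ ℕ.+ n′) piv * vandermondeProduct (m₀ ℕ.+ n′) nod ≈
              (ΠN m₀ piv₀ * vandermondeProduct m₀ nod₀) *
              (ΠN m₀ (λ s → ΠN n′ (λ t → nod′ t + - (q ^ℕ s * X F.zero))) * (ΠN n′ piv′ * vandermondeProduct n′ nod′))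
      split = begin
        ΠN (m₀ ℕ.+ n′) piv * vandermondeProduct (m₀ ℕ.+ n′) nod
          ≈⟨ *-cong (ΠN-split m₀ n′ piv) (vandermondeProduct-split m₀ n′ nod) ⟩
        (ΠN m₀ piv * ΠN n′ (λ i → piv (m₀ ℕ.+ i))) *
          ((vandermondeProduct m₀ nod * vandermondeProduct n′ (λ i → nod (m₀ ℕ.+ i))) *
           ΠN m₀ (λ s → ΠN n′ (λ t → nod (m₀ ℕ.+ t) + - nod s)))
          ≈⟨ *-cong (*-cong (ΠN-cong m₀ λ i i<m₀ → first i i<m₀) (ΠN-cong n′ λ i _ → rest i))
                    (*-cong (*-cong (vandermondeProduct-cong m₀ λ i i<m₀ → first i i<m₀) (vandermondeProduct-cong n′ λ i _ → rest i))
                            (ΠN-cong m₀ λ s s<m₀ → ΠN-cong n′ λ t _ → +-cong (rest t) (-‿cong (first s s<m₀)))) ⟩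
        (ΠN m₀ piv₀ * ΠN n′ piv′) *
          ((vandermondeProduct m₀ nod₀ * vandermondeProduct n′ nod′) *
           ΠN m₀ (λ s → ΠN n′ (λ t → nod′ t + - (q ^ℕ s * X F.zero))))
          ≈⟨ solve 5 (λ a a′ v v′ c → (a :* a′) :* ((v :* v′) :* c) := (a :* v) :* (c :* (a′ :* v′))) refl _ _ _ _ _ ⟩
        (ΠN m₀ piv₀ * vandermondeProduct m₀ nod₀) *
          (ΠN m₀ (λ s → ΠN n′ (λ t → nod′ t + - (q ^ℕ s * X F.zero))) * (ΠN n′ piv′ * vandermondeProduct n′ nod′)) ∎
        where
        first : ∀ {f d} i → i < m₀ → byColumn (suc ℓ) m f d i ≈ f F.zero i
        first i i<m₀ = reflexive (byColumn-first ℓ m _ _ i i<m₀)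
        rest : ∀ {f d} i → byColumn (suc ℓ) m f d (m₀ ℕ.+ i) ≈ byColumn ℓ (m ∘ F.suc) (f ∘ F.suc) d i
        rest i = reflexive (byColumn-shift ℓ m _ _ i)

  pivots*vandermonde≈closedForm : ∀ ℓ m X Xi → (∀ i → X i * Xi i ≈ 1#) →
    ΠN (sumℕ ℓ m) (pivot ℓ m X Xi) * vandermondeProduct (sumℕ ℓ m) (node ℓ m X Xi) ≈
    (Q ^ℕ N₁C ℓ m * q ^ℕ qExponent ℓ m) * (factProd ℓ m * vdmProd ℓ m X)
  pivots*vandermonde≈closedForm zero    m X Xi _      = sym (trans (*-congʳ (*-identityˡ 1#)) (*-identityˡ _))
  pivots*vandermonde≈closedForm (suc ℓ) m X Xi X*Xi≈1 = begin
    ΠN (m₀ ℕ.+ n′) piv * vandermondeProduct (m₀ ℕ.+ n′) nod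
      ≈⟨ split ⟩
    (ΠN m₀ piv₀ * vandermondeProduct m₀ nod₀) *
      (ΠN m₀ (λ s → ΠN n′ (λ t → nod′ t + - (q ^ℕ s * X F.zero))) * (ΠN n′ piv′ * vandermondeProduct n′ nod′))
      ≈⟨ *-cong (block-contribution (X*Xi≈1 F.zero) m₀)
                (*-cong (cross-terms ℓ (m ∘ F.suc) (X ∘ F.suc) (Xi ∘ F.suc) (X F.zero) m₀)
                        (pivots*vandermonde≈closedForm ℓ (m ∘ F.suc) (X ∘ F.suc) (Xi ∘ F.suc) (X*Xi≈1 ∘ F.suc))) ⟩
    (Q ^ℕ E₀ * F₀) * ((q ^ℕ K₀ * V₀) * ((Q ^ℕ N₁C ℓ (m ∘ F.suc) * q ^ℕ qExponent ℓ (m ∘ F.suc)) *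
                                       (factProd ℓ (m ∘ F.suc) * vdmProd ℓ (m ∘ F.suc) (X ∘ F.suc))))
      ≈⟨ solve 8 (λ a b c d e f g h → (a :* b) :* ((c :* d) :* ((e :* f) :* (g :* h)))
                                       := ((a :* e) :* (c :* f)) :* ((b :* g) :* (d :* h))) refl _ _ _ _ _ _ _ _ ⟩
    ((Q ^ℕ E₀ * Q ^ℕ N₁C ℓ (m ∘ F.suc)) * (q ^ℕ K₀ * q ^ℕ qExponent ℓ (m ∘ F.suc))) *
      ((F₀ * factProd ℓ (m ∘ F.suc)) * (V₀ * vdmProd ℓ (m ∘ F.suc) (X ∘ F.suc)))
      ≈⟨ *-cong (*-cong (sym (^ℕ-homo-* Q E₀ _)) (sym (^ℕ-homo-* q K₀ _)))
                (*-cong (*-congʳ (sym (prodR≈ΠN (m₀ ∸ 1) λ j → qfact≈qfactorial (suc (toℕ j)))))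
                        (sym (vdmProd-suc ℓ m X))) ⟩
    (Q ^ℕ N₁C (suc ℓ) m * q ^ℕ qExponent (suc ℓ) m) * (factProd (suc ℓ) m * vdmProd (suc ℓ) m X) ∎
    where
    open FirstBlock ℓ m X Xi
    E₀ = sumℕ m₀ (λ j → m₀ ∸ suc (toℕ j))
    F₀ = ΠN (m₀ ∸ 1) (λ j → qfactorial (suc j))
    K₀ = Σℕ m₀ (λ s → s) ℕ.* n′
    V₀ = prodR ℓ (λ j → prodR m₀ (λ s → prodR (m (F.suc j)) (λ t →
           zpow q qi (+ toℕ t ℤ.- + toℕ s) * X (F.suc j) + - X F.zero)))

theorem23 : ∀ {c r : Level} (R : CommutativeRing c r) →
    let open CommutativeRing R in
    let open RingDefs R in
    (n ℓ : ℕ) (m : Fin ℓ → ℕ) →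
    (∀ i → 1 ≤ m i) → sumℕ ℓ m ≡ n →
    (q qi w Q : Carrier) (X Xi : Fin ℓ → Carrier) →
    q * qi ≈ 1# → (1# − q) * w ≈ 1# → (∀ i → X i * Xi i ≈ 1#) →
    let open QNotation q qi w Q in
    det n (blockMatrix n ℓ m X Xi)
      ≈ qN₁ ℓ m * (factProd ℓ m * vdmProd ℓ m X)
theorem23 R n ℓ m _ ≡.refl q qi w Q X Xi q*qi≈1 _ X*Xi≈1 = begin
  det n (blockMatrix n ℓ m X Xi)                          ≈⟨ det-blockMatrix ℓ m X Xi ⟩
  detℕ n (entry ℓ m X Xi)                                 ≈⟨ detℕ-entry ℓ m X Xi q*qi≈1 X*Xi≈1 ⟩
  ΠN n (pivot ℓ m X Xi) * vandermondeProduct n (node ℓ m X Xi)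
                                                          ≈⟨ pivots*vandermonde≈closedForm ℓ m X Xi X*Xi≈1 ⟩
  (Q ^ℕ N₁C ℓ m * q ^ℕ qExponent ℓ m) * (factProd ℓ m * vdmProd ℓ m X)
                                                          ≡⟨ ≡.cong (λ z → (Q ^ℕ N₁C ℓ m * zpow q qi z) * (factProd ℓ m * vdmProd ℓ m X))
                                                                    (≡.sym (N₁const≡qExponent ℓ m)) ⟩
  qN₁ ℓ m * (factProd ℓ m * vdmProd ℓ m X)                ∎
  where
  open RingToolkit R
  open QNotation q qi w Q
  open Determinant R using (detℕ)
  open Vandermonde R using (vandermondeProduct)
  open BlockMatrix R q qi w Q
  open ClosedForm R q qi w Q q*qi≈1
  open Exponent using (qExponent; N₁const≡qExponent)
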